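{- Let $p$ be an odd prime, $G=\mathrm{SL}(2,p)$, $N=Z(G)$, $b=\begin{pmatrix}1&0\\1&1\end{pmatrix}$, $w=\begin{pmatrix}1&1\\0&1\end{pmatrix}$, and let $\Gamma$ be the bipartite graph with black vertices the right cosets of $\langle b\rangle$, white vertices the right cosets of $\langle w\rangle$, and edge set $G$, the edge $g$ joining $\langle b\rangle g$ and $\langle w\rangle g$. Let $\mathcal{D}$ be a regular dessin with $\mathrm{Aut}\,\mathcal{D}\cong G$ and underlying graph $\Gamma$. Then: (i) $\mathcal{D}\cong\mathcal{D}(G,b,w^i)$ for some $i$ with $1\le i\le p-1$; (ii) $\mathcal{D}(G,b,w^i)\not\cong\mathcal{D}(G,b,w^j)$ for $1\le i\ne j\le p-1$; (iii) $\mathcal{D}$ is a smooth covering of $\mathcal{D}_N$ if and only if $\mathcal{D}\cong\mathcal{D}(G,b,w^i)$ with $|bw^i|$ odd.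
   Context: For a finite group $G=\langle x,y\rangle$, $\mathcal{D}(G,x,y)$ is the regular dessin with black vertices the right cosets of $\langle x\rangle$, white vertices the right cosets of $\langle y\rangle$, edges the elements of $G$, faces corresponding to right cosets of $\langle xy\rangle$; every regular dessin is of this form with $G$ its automorphism group, and isomorphisms preserve colours, incidence and orientation. For $N\trianglelefteq G$, $\mathcal{D}_N=\mathcal{D}(G/N,xN,yN)$, and $\mathcal{D}$ is a smooth covering of $\mathcal{D}_N$ if $(|x|,|y|,|xy|)=(|xN|,|yN|,|xyN|)$. -}

module Defs where

open import Data.Nat using (ℕ; zero; suc; _+_; _*_; _∸_; _≤_; _<_; NonZero)
open import Data.Nat.DivMod using (_mod_)
open import Data.Fin using (Fin; toℕ)
open import Data.Product using (Σ; _×_; ∃)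
open import Relation.Binary.PropositionalEquality using (_≡_; _≢_)
open import Relation.Nullary using (¬_)
open import Function.Bundles using (_⇔_)

module SL2 (p : ℕ) .{{nz : NonZero p}} where

  F : Set
  F = Fin p

  fromℕ : ℕ → F
  fromℕ n = n mod p

  0F 1F : F
  0F = fromℕ 0
  1F = fromℕ 1

  _+F_ _*F_ _-F_ : F → F → F
  a +F b = fromℕ (toℕ a + toℕ b)
  a *F b = fromℕ (toℕ a * toℕ b)
  a -F b = fromℕ (toℕ a + (p ∸ toℕ b))

  -F_ : F → F
  -F a = fromℕ (p ∸ toℕ a)

  record M2 : Set where
    constructor mat
    field
      a b c d : F

  _·_ : M2 → M2 → M2
  mat a b c d · mat a' b' c' d' =
    mat ((a *F a') +F (b *F c')) ((a *F b') +F (b *F d'))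
        ((c *F a') +F (d *F c')) ((c *F b') +F (d *F d'))

  det : M2 → F
  det (mat a b c d) = (a *F d) -F (b *F c)

  I : M2
  I = mat 1F 0F 0F 1F

  -- inverse of a determinant-one matrix (adjugate)
  inv : M2 → M2
  inv (mat a b c d) = mat d (-F b) (-F c) a

  pow : M2 → ℕ → M2
  pow g zero = I
  pow g (suc n) = pow g n · g

  SL : M2 → Set
  SL g = det g ≡ 1F

  bM wM : M2
  bM = mat 1F 0F 1F 1F
  wM = mat 1F 1F 0F 1F

  data Gen (x y : M2) : M2 → Set where
    gen-I  : Gen x y I
    gen-x  : ∀ {g} → Gen x y g → Gen x y (g · x)
    gen-y  : ∀ {g} → Gen x y g → Gen x y (g · y)
    gen-x⁻ : ∀ {g} → Gen x y g → Gen x y (g · inv x)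
    gen-y⁻ : ∀ {g} → Gen x y g → Gen x y (g · inv y)

  Generates : M2 → M2 → Set
  Generates x y = ∀ g → SL g → Gen x y g

  BijectiveOnG : (M2 → M2) → Set
  BijectiveOnG f =
    (∀ g → SL g → SL (f g)) ×
    Σ (M2 → M2) λ h → (∀ g → SL g → SL (h g)) ×
      (∀ g → SL g → h (f g) ≡ g) × (∀ g → SL g → f (h g) ≡ g)

  -- Isomorphism of regular dessins D(G,x,y) ≅ D(G,x',y'): a bijection of the
  -- edge sets (= G) preserving colours, incidence and orientation, i.e.
  -- commuting with the rotations about black (g ↦ x g) and white (g ↦ y g)
  -- vertices.
  DessinIso : M2 → M2 → M2 → M2 → Set
  DessinIso x y x' y' = Σ (M2 → M2) λ f → BijectiveOnG f ×
    (∀ g → SL g → f (x · g) ≡ x' · f g) ×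
    (∀ g → SL g → f (y · g) ≡ y' · f g)

  -- g and h lie in the same right coset of ⟨x⟩ (⟨x⟩ finite, so
  -- nonnegative powers suffice)
  SameCoset : M2 → M2 → M2 → Set
  SameCoset x g h = ∃ λ k → h ≡ pow x k · g

  -- colour-preserving isomorphism between the underlying bipartite graph of
  -- D(G,x,y) and Γ: a bijection on edges inducing bijections on black
  -- vertices (right cosets of ⟨x⟩ resp. ⟨b⟩) and white vertices (right
  -- cosets of ⟨y⟩ resp. ⟨w⟩), compatible with incidence.
  UnderlyingGraphIsΓ : M2 → M2 → Set
  UnderlyingGraphIsΓ x y = Σ (M2 → M2) λ f → BijectiveOnG f ×
    (∀ g h → SL g → SL h → SameCoset x g h ⇔ SameCoset bM (f g) (f h)) ×
    (∀ g h → SL g → SL h → SameCoset y g h ⇔ SameCoset wM (f g) (f h))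

  HasOrder : M2 → ℕ → Set
  HasOrder g n = 0 < n × pow g n ≡ I × (∀ m → 0 < m → m < n → pow g m ≢ I)

  Central : M2 → Set
  Central z = SL z × (∀ h → SL h → z · h ≡ h · z)

  HasOrderModN : M2 → ℕ → Set
  HasOrderModN g n = 0 < n × Central (pow g n) ×
    (∀ m → 0 < m → m < n → ¬ Central (pow g m))

  SameOrderModN : M2 → Set
  SameOrderModN g = ∃ λ n → HasOrder g n × HasOrderModN g n

  -- D(G,x,y) is a smooth covering of D_N:
  -- (|x|,|y|,|xy|) = (|xN|,|yN|,|xyN|)
  SmoothCover : M2 → M2 → Set
  SmoothCover x y = SameOrderModN x × SameOrderModN y × SameOrderModN (x · y)

{-# OPTIONS --safe #-}
module Submission where

-- x and y have order p, like b and w, because the cosets of ⟨x⟩ and ⟨y⟩ match those of ⟨b⟩ and ⟨w⟩.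
-- In characteristic p, (g - I)ᵖ = gᵖ - I, so gᵖ = I forces det (g - I) = 2 - tr g to vanish: x and
-- y are unipotent. Conjugations are dessin isomorphisms. One in GL(2,p) moves x to b, and a further
-- one by a lower unitriangular matrix (these commute with b) moves y to an upper unitriangular wⁱ.
-- This fails only if y becomes lower unitriangular itself, but then ⟨x,y⟩ would fix e₂ and could not
-- contain -I.
-- Dessin isomorphisms preserve the relations between the generators. If 1 + im ≡ 0 (mod p) then
-- wⁱ bᵐ wⁱ is traceless, so it has order 4; under an isomorphism D(G,b,wⁱ) ≅ D(G,b,wʲ) so does
-- wʲ bᵐ wʲ, which is therefore traceless as well, and this forces i = j.
-- Finally Z(G) = {±I} and -I is the only involution, so an element has the same order modulo Z(G)
-- exactly when its order is odd.

open import Defs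
open import Data.Nat.Base as ℕ using (ℕ; zero; suc; NonZero; _%_; _!; _≤_; _∸_)
import Data.Nat.Properties as ℕ
import Data.Nat.Combinatorics as ℕ
open import Data.Nat.DivMod
  using (_mod_; _/_; m/n*n≡m; m%n<n; m%n%n≡m%n; %-distribˡ-+; %-distribˡ-*; m<n⇒m%n≡m; m≡m%n+[m/n]*n)
open import Data.Nat.Divisibility using (_∣_; divides; m%n≡0⇒n∣m; n∣m⇒m%n≡0; ∣⇒≤; n∣m*n; m∣m*n)
open import Data.Nat.Primality
  using (Prime; prime?; euclidsLemma; prime⇒nonTrivial; prime⇒nonZero; prime⇒irreducible)
open import Data.Nat.Coprimality using (Coprime; coprime-Bézout; coprime-divisor; prime⇒coprime)
open import Data.Nat.GCD using (module Bézout)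
open import Data.Fin.Base as Fin using (Fin; toℕ)
import Data.Fin.Properties as Fin
open import Data.Integer.Base as ℤ using (ℤ; -[1+_]; _⊖_; 0ℤ; 1ℤ)
import Data.Integer.Properties as ℤ
import Data.Sign.Base as Sign
open import Data.Product.Base using (Σ; ∃; ∃₂; _×_; _,_; proj₁; proj₂)
open import Data.Sum.Base as Sum using (_⊎_; inj₁; inj₂; [_,_]′)
open import Data.Maybe.Base using (Maybe; just; nothing)
open import Data.Empty using (⊥)
open import Function.Base using (id)
open import Function.Bundles using (_⇔_; Equivalence; mk⇔)
open import Relation.Nullary.Decidable using (Dec; yes; no; from-yes)
open import Relation.Nullary.Negation using (¬_; contradiction)
open import Relation.Binary.PropositionalEquality
  using (_≡_; _≢_; refl; sym; trans; cong; cong₂; subst; subst₂; isEquivalence; module ≡-Reasoning)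
open import Algebra.Bundles using (Semiring; CommutativeRing; Ring; Monoid)
open import Algebra.Structures using (IsCommutativeRing; IsRing)
import Algebra.Properties.Ring as RingProperties
import Algebra.Properties.CommutativeSemigroup as CommutativeSemigroupProperties
import Algebra.Solver.Ring
import Algebra.Solver.Ring.AlmostCommutativeRing as ACR
import Algebra.Solver.Monoid

-- Binomial coefficients in prime characteristic

¬prime∣! : ∀ {q} → Prime q → ∀ m → m ℕ.< q → ¬ q ∣ m !
¬prime∣! q-prime zero    _   q∣1 = ℕ.<⇒≱ (ℕ.nonTrivial⇒n>1 _ {{prime⇒nonTrivial q-prime}}) (∣⇒≤ q∣1)
¬prime∣! q-prime (suc m) m<q q∣[1+m]! with euclidsLemma (suc m) (m !) q-prime q∣[1+m]!
... | inj₁ q∣1+m = ℕ.<⇒≱ m<q (∣⇒≤ q∣1+m)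
... | inj₂ q∣m!  = ¬prime∣! q-prime m (ℕ.<-trans (ℕ.n<1+n m) m<q) q∣m!

n∣n! : ∀ n → .{{NonZero n}} → n ∣ n !
n∣n! (suc m) = m∣m*n (m !)

prime∣C : ∀ {q k} → Prime q → 0 ℕ.< k → k ℕ.< q → q ∣ q ℕ.C k
prime∣C {q} {k} q-prime 0<k k<q with euclidsLemma (q ℕ.C k) (k ! ℕ.* (q ∸ k) !) q-prime q∣C·k!·[q-k]!
  where
  instance _ = prime⇒nonZero q-prime
  C·k!·[q-k]!≡q! : (q ℕ.C k) ℕ.* (k ! ℕ.* (q ∸ k) !) ≡ q !
  C·k!·[q-k]!≡q! = trans (cong (ℕ._* (k ! ℕ.* (q ∸ k) !)) (ℕ.nCk≡n!/k![n-k]! (ℕ.<⇒≤ k<q)))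
                          (m/n*n≡m {{ℕ._!*_!≢0 k (q ∸ k)}} (ℕ.k![n∸k]!∣n! (ℕ.<⇒≤ k<q)))
  q∣C·k!·[q-k]! : q ∣ (q ℕ.C k) ℕ.* (k ! ℕ.* (q ∸ k) !)
  q∣C·k!·[q-k]! = subst (q ∣_) (sym C·k!·[q-k]!≡q!) (n∣n! q)
... | inj₁ q∣C = q∣C
... | inj₂ q∣k!·[q-k]! with euclidsLemma (k !) ((q ∸ k) !) q-prime q∣k!·[q-k]!
...   | inj₁ q∣k!     = contradiction q∣k! (¬prime∣! q-prime k k<q)
...   | inj₂ q∣[q-k]! = contradiction q∣[q-k]! (¬prime∣! q-prime (q ∸ k) (ℕ.∸-monoʳ-< {q} {k} {0} 0<k (ℕ.<⇒≤ k<q)))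

module _ {a ℓ} (S : Semiring a ℓ) where
  open Semiring S renaming (refl to ≈-refl; sym to ≈-sym; trans to ≈-trans)
  open import Algebra.Properties.Semiring.Exp S using (_^_)
  open import Algebra.Properties.Semiring.Mult S using (×-homo-1; ×-assocˡ; ×-assoc-*; ×-congʳ)
    renaming (_×_ to _×ₙ_)
  open import Algebra.Properties.Semiring.Sum S using (sum; sum-init-last; sum-cong-≋; sum-replicate-zero)
  open import Relation.Binary.Reasoning.Setoid setoid

  1#^n≈1# : ∀ n → 1# ^ n ≈ 1#
  1#^n≈1# zero    = ≈-refl
  1#^n≈1# (suc n) = ≈-trans (*-identityˡ (1# ^ n)) (1#^n≈1# n)

  -- the binomial theorem, whose middle terms are multiples of q
  [x+1]^q≈1+x^q : ∀ {q} → Prime q → q ×ₙ 1# ≈ 0# → ∀ x → (x + 1#) ^ q ≈ 1# + x ^ q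
  [x+1]^q≈1+x^q {zero}  q-prime _ _ = contradiction refl (ℕ.≢-nonZero⁻¹ 0 {{prime⇒nonZero q-prime}})
  [x+1]^q≈1+x^q {suc r} q-prime q×1≈0 x = begin
    (x + 1#) ^ q                                    ≈⟨ theorem x*1≈1*x q ⟩
    term Fin.zero + sum (λ i → term (Fin.suc i))    ≈⟨ +-cong first-term (sum-init-last (λ i → term (Fin.suc i))) ⟩
    1# + (sum (λ i → term (Fin.suc (Fin.inject₁ i))) + term (Fin.suc (Fin.fromℕ r)))
                                                    ≈⟨ +-congˡ (+-cong middle-terms last-term) ⟩
    1# + (0# + x ^ q)                               ≈⟨ +-congˡ (+-identityˡ (x ^ q)) ⟩
    1# + x ^ q                                      ∎
    where
    q = suc r
    open import Algebra.Properties.Semiring.Binomial S x 1# using (theorem; binomialTerm)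
    term : Fin (suc q) → Carrier
    term = binomialTerm q
    x*1≈1*x : x * 1# ≈ 1# * x
    x*1≈1*x = ≈-trans (*-identityʳ x) (≈-sym (*-identityˡ x))
    first-term : term Fin.zero ≈ 1#
    first-term = begin
      1 ×ₙ (1# * 1# ^ q)   ≈⟨ ×-homo-1 (1# * 1# ^ q) ⟩
      1# * 1# ^ q          ≈⟨ *-identityˡ (1# ^ q) ⟩
      1# ^ q               ≈⟨ 1#^n≈1# q ⟩
      1#                   ∎
    last-term : term (Fin.suc (Fin.fromℕ r)) ≈ x ^ q
    last-term = begin
      term (Fin.suc (Fin.fromℕ r))             ≡⟨ cong (λ j → (q ℕ.C suc j) ×ₙ (x ^ suc j * 1# ^ (q ∸ suc j))) (Fin.toℕ-fromℕ r) ⟩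
      (q ℕ.C q) ×ₙ (x ^ q * 1# ^ (q ∸ q))      ≡⟨ cong₂ (λ c n → c ×ₙ (x ^ q * 1# ^ n)) (ℕ.nCn≡1 q) (ℕ.n∸n≡0 q) ⟩
      1 ×ₙ (x ^ q * 1#)                        ≈⟨ ×-homo-1 (x ^ q * 1#) ⟩
      x ^ q * 1#                               ≈⟨ *-identityʳ (x ^ q) ⟩
      x ^ q                                    ∎
    C×ₙ≈0 : ∀ k y → 0 ℕ.< k → k ℕ.< q → (q ℕ.C k) ×ₙ y ≈ 0#
    C×ₙ≈0 k y 0<k k<q with divides m C≡m*q ← prime∣C q-prime 0<k k<q = begin
      (q ℕ.C k) ×ₙ y           ≡⟨ cong (_×ₙ y) (trans C≡m*q (ℕ.*-comm m q)) ⟩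
      (q ℕ.* m) ×ₙ y           ≈⟨ ×-assocˡ y q m ⟨
      q ×ₙ (m ×ₙ y)            ≈⟨ ×-congʳ q (*-identityˡ (m ×ₙ y)) ⟨
      q ×ₙ (1# * (m ×ₙ y))     ≈⟨ ×-assoc-* q 1# (m ×ₙ y) ⟨
      (q ×ₙ 1#) * (m ×ₙ y)     ≈⟨ *-congʳ q×1≈0 ⟩
      0# * (m ×ₙ y)            ≈⟨ zeroˡ (m ×ₙ y) ⟩
      0#                       ∎
    middle-terms : sum (λ i → term (Fin.suc (Fin.inject₁ i))) ≈ 0#
    middle-terms = ≈-trans
      (sum-cong-≋ λ i → C×ₙ≈0 (suc (toℕ (Fin.inject₁ i))) _ (ℕ.s≤s ℕ.z≤n)
                          (ℕ.s≤s (subst (ℕ._< r) (sym (Fin.toℕ-inject₁ i)) (Fin.toℕ<n i))))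
      (sum-replicate-zero r)

odd⇒coprime-2 : ∀ {n} → ¬ 2 ∣ n → Coprime n 2
odd⇒coprime-2 n-odd (i∣n , i∣2) with prime⇒irreducible (from-yes (prime? 2)) i∣2
... | inj₁ i≡1  = i≡1
... | inj₂ refl = contradiction i∣n n-odd

module Dessins (p : ℕ) .{{_ : NonZero p}} where
  open SL2 p
  open ≡-Reasoning

  -- ℤ/pℤ as a commutative ring

  toℕ-fromℕ : ∀ n → toℕ (fromℕ n) ≡ n % p
  toℕ-fromℕ n = Fin.toℕ-fromℕ< (m%n<n n p)

  fromℕ-≡ : ∀ {m n} → m % p ≡ n % p → fromℕ m ≡ fromℕ n
  fromℕ-≡ {m} {n} m≡n = Fin.toℕ-injective (begin
    toℕ (fromℕ m)   ≡⟨ toℕ-fromℕ m ⟩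
    m % p           ≡⟨ m≡n ⟩
    n % p           ≡⟨ toℕ-fromℕ n ⟨
    toℕ (fromℕ n)   ∎)

  fromℕ-injective : ∀ {m n} → m ℕ.< p → n ℕ.< p → fromℕ m ≡ fromℕ n → m ≡ n
  fromℕ-injective {m} {n} m<p n<p eq = begin
    m               ≡⟨ m<n⇒m%n≡m m<p ⟨
    m % p           ≡⟨ toℕ-fromℕ m ⟨
    toℕ (fromℕ m)   ≡⟨ cong toℕ eq ⟩
    toℕ (fromℕ n)   ≡⟨ toℕ-fromℕ n ⟩
    n % p           ≡⟨ m<n⇒m%n≡m n<p ⟩
    n               ∎

  fromℕ-toℕ : ∀ a → fromℕ (toℕ a) ≡ a
  fromℕ-toℕ a = Fin.toℕ-injective (trans (toℕ-fromℕ (toℕ a)) (m<n⇒m%n≡m (Fin.toℕ<n a)))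

  toℕ-0F : toℕ 0F ≡ 0
  toℕ-0F = trans (toℕ-fromℕ 0) (m<n⇒m%n≡m (ℕ.>-nonZero⁻¹ p))

  fromℕ≡0⇒p∣ : ∀ n → fromℕ n ≡ 0F → p ∣ n
  fromℕ≡0⇒p∣ n n≡0 = m%n≡0⇒n∣m n p (trans (sym (toℕ-fromℕ n)) (trans (cong toℕ n≡0) toℕ-0F))

  p∣⇒fromℕ≡0 : ∀ n → p ∣ n → fromℕ n ≡ 0F
  p∣⇒fromℕ≡0 n p∣n = fromℕ-≡ (trans (n∣m⇒m%n≡0 n p p∣n) (sym (m<n⇒m%n≡m (ℕ.>-nonZero⁻¹ p))))

  fromℕ-p : fromℕ p ≡ 0F
  fromℕ-p = p∣⇒fromℕ≡0 p (divides 1 (sym (ℕ.*-identityˡ p)))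

  toℕ≡0⇒≡0F : ∀ a → toℕ a ≡ 0 → a ≡ 0F
  toℕ≡0⇒≡0F a a≡0 = trans (sym (fromℕ-toℕ a)) (cong fromℕ a≡0)

  p∣toℕ⇒≡0F : ∀ a → p ∣ toℕ a → a ≡ 0F
  p∣toℕ⇒≡0F a p∣a = trans (sym (fromℕ-toℕ a)) (p∣⇒fromℕ≡0 (toℕ a) p∣a)

  +-reduceˡ : ∀ m n → fromℕ (toℕ (fromℕ m) ℕ.+ n) ≡ fromℕ (m ℕ.+ n)
  +-reduceˡ m n = fromℕ-≡ (begin
    (toℕ (fromℕ m) ℕ.+ n) % p      ≡⟨ cong (λ k → (k ℕ.+ n) % p) (toℕ-fromℕ m) ⟩
    (m % p ℕ.+ n) % p              ≡⟨ %-distribˡ-+ (m % p) n p ⟩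
    (m % p % p ℕ.+ n % p) % p      ≡⟨ cong (λ k → (k ℕ.+ n % p) % p) (m%n%n≡m%n m p) ⟩
    (m % p ℕ.+ n % p) % p          ≡⟨ %-distribˡ-+ m n p ⟨
    (m ℕ.+ n) % p                  ∎)

  *-reduceˡ : ∀ m n → fromℕ (toℕ (fromℕ m) ℕ.* n) ≡ fromℕ (m ℕ.* n)
  *-reduceˡ m n = fromℕ-≡ (begin
    (toℕ (fromℕ m) ℕ.* n) % p      ≡⟨ cong (λ k → (k ℕ.* n) % p) (toℕ-fromℕ m) ⟩
    (m % p ℕ.* n) % p              ≡⟨ %-distribˡ-* (m % p) n p ⟩
    (m % p % p ℕ.* (n % p)) % p    ≡⟨ cong (λ k → (k ℕ.* (n % p)) % p) (m%n%n≡m%n m p) ⟩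
    (m % p ℕ.* (n % p)) % p        ≡⟨ %-distribˡ-* m n p ⟨
    (m ℕ.* n) % p                  ∎)

  +-reduceʳ : ∀ m n → fromℕ (m ℕ.+ toℕ (fromℕ n)) ≡ fromℕ (m ℕ.+ n)
  +-reduceʳ m n = begin
    fromℕ (m ℕ.+ toℕ (fromℕ n))   ≡⟨ cong fromℕ (ℕ.+-comm m (toℕ (fromℕ n))) ⟩
    fromℕ (toℕ (fromℕ n) ℕ.+ m)   ≡⟨ +-reduceˡ n m ⟩
    fromℕ (n ℕ.+ m)               ≡⟨ cong fromℕ (ℕ.+-comm n m) ⟩
    fromℕ (m ℕ.+ n)               ∎

  *-reduceʳ : ∀ m n → fromℕ (m ℕ.* toℕ (fromℕ n)) ≡ fromℕ (m ℕ.* n)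
  *-reduceʳ m n = begin
    fromℕ (m ℕ.* toℕ (fromℕ n))   ≡⟨ cong fromℕ (ℕ.*-comm m (toℕ (fromℕ n))) ⟩
    fromℕ (toℕ (fromℕ n) ℕ.* m)   ≡⟨ *-reduceˡ n m ⟩
    fromℕ (n ℕ.* m)               ≡⟨ cong fromℕ (ℕ.*-comm n m) ⟩
    fromℕ (m ℕ.* n)               ∎

  fromℕ-+ : ∀ m n → fromℕ (m ℕ.+ n) ≡ fromℕ m +F fromℕ n
  fromℕ-+ m n = sym (trans (+-reduceˡ m (toℕ (fromℕ n))) (+-reduceʳ m n))

  fromℕ-* : ∀ m n → fromℕ (m ℕ.* n) ≡ fromℕ m *F fromℕ n
  fromℕ-* m n = sym (trans (*-reduceˡ m (toℕ (fromℕ n))) (*-reduceʳ m n))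

  +F-assoc : ∀ a b c → (a +F b) +F c ≡ a +F (b +F c)
  +F-assoc a b c = begin
    (a +F b) +F c                         ≡⟨ +-reduceˡ (toℕ a ℕ.+ toℕ b) (toℕ c) ⟩
    fromℕ (toℕ a ℕ.+ toℕ b ℕ.+ toℕ c)     ≡⟨ cong fromℕ (ℕ.+-assoc (toℕ a) (toℕ b) (toℕ c)) ⟩
    fromℕ (toℕ a ℕ.+ (toℕ b ℕ.+ toℕ c))   ≡⟨ +-reduceʳ (toℕ a) (toℕ b ℕ.+ toℕ c) ⟨
    a +F (b +F c)                         ∎

  *F-assoc : ∀ a b c → (a *F b) *F c ≡ a *F (b *F c)
  *F-assoc a b c = begin
    (a *F b) *F c                         ≡⟨ *-reduceˡ (toℕ a ℕ.* toℕ b) (toℕ c) ⟩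
    fromℕ (toℕ a ℕ.* toℕ b ℕ.* toℕ c)     ≡⟨ cong fromℕ (ℕ.*-assoc (toℕ a) (toℕ b) (toℕ c)) ⟩
    fromℕ (toℕ a ℕ.* (toℕ b ℕ.* toℕ c))   ≡⟨ *-reduceʳ (toℕ a) (toℕ b ℕ.* toℕ c) ⟨
    a *F (b *F c)                         ∎

  +F-comm : ∀ a b → a +F b ≡ b +F a
  +F-comm a b = cong fromℕ (ℕ.+-comm (toℕ a) (toℕ b))

  *F-comm : ∀ a b → a *F b ≡ b *F a
  *F-comm a b = cong fromℕ (ℕ.*-comm (toℕ a) (toℕ b))

  +F-identityˡ : ∀ a → 0F +F a ≡ a
  +F-identityˡ a = trans (+-reduceˡ 0 (toℕ a)) (fromℕ-toℕ a)

  *F-identityˡ : ∀ a → 1F *F a ≡ a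
  *F-identityˡ a = begin
    1F *F a               ≡⟨ *-reduceˡ 1 (toℕ a) ⟩
    fromℕ (1 ℕ.* toℕ a)   ≡⟨ cong fromℕ (ℕ.*-identityˡ (toℕ a)) ⟩
    fromℕ (toℕ a)         ≡⟨ fromℕ-toℕ a ⟩
    a                     ∎

  -F-inverseˡ : ∀ a → (-F a) +F a ≡ 0F
  -F-inverseˡ a = begin
    (-F a) +F a                     ≡⟨ +-reduceˡ (p ∸ toℕ a) (toℕ a) ⟩
    fromℕ (p ∸ toℕ a ℕ.+ toℕ a)     ≡⟨ cong fromℕ (ℕ.m∸n+n≡m (ℕ.<⇒≤ (Fin.toℕ<n a))) ⟩
    fromℕ p                         ≡⟨ fromℕ-p ⟩
    0F                              ∎

  *F-distribʳ : ∀ a b c → (b +F c) *F a ≡ (b *F a) +F (c *F a)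
  *F-distribʳ a b c = begin
    (b +F c) *F a                                 ≡⟨ *-reduceˡ (toℕ b ℕ.+ toℕ c) (toℕ a) ⟩
    fromℕ ((toℕ b ℕ.+ toℕ c) ℕ.* toℕ a)           ≡⟨ cong fromℕ (ℕ.*-distribʳ-+ (toℕ a) (toℕ b) (toℕ c)) ⟩
    fromℕ (toℕ b ℕ.* toℕ a ℕ.+ toℕ c ℕ.* toℕ a)   ≡⟨ fromℕ-+ (toℕ b ℕ.* toℕ a) (toℕ c ℕ.* toℕ a) ⟩
    (b *F a) +F (c *F a)                          ∎

  +-*-isCommutativeRing : IsCommutativeRing _≡_ _+F_ _*F_ -F_ 0F 1F
  +-*-isCommutativeRing = record
    { isRing = record
      { +-isAbelianGroup = record
        { isGroup = record
          { isMonoid = record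
            { isSemigroup = record
              { isMagma = record { isEquivalence = isEquivalence ; ∙-cong = cong₂ _+F_ }
              ; assoc = +F-assoc }
            ; identity = +F-identityˡ , λ a → trans (+F-comm a 0F) (+F-identityˡ a) }
          ; inverse = -F-inverseˡ , λ a → trans (+F-comm a (-F a)) (-F-inverseˡ a)
          ; ⁻¹-cong = cong (λ a → -F a) }
        ; comm = +F-comm }
      ; *-cong = cong₂ _*F_
      ; *-assoc = *F-assoc
      ; *-identity = *F-identityˡ , λ a → trans (*F-comm a 1F) (*F-identityˡ a)
      ; distrib = (λ a b c → trans (*F-comm a (b +F c)) (trans (*F-distribʳ a b c) (cong₂ _+F_ (*F-comm b a) (*F-comm c a))))
                , *F-distribʳ }
    ; *-comm = *F-comm }

  +-*-commutativeRing : CommutativeRing _ _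
  +-*-commutativeRing = record { isCommutativeRing = +-*-isCommutativeRing }

  open CommutativeRing +-*-commutativeRing
    using (_+_; _*_; -_; _-_; +-assoc; +-comm; +-identityˡ; +-identityʳ; -‿inverseˡ; -‿inverseʳ;
           *-assoc; *-comm; *-identityˡ; *-identityʳ; zeroˡ; zeroʳ; +-commutativeSemigroup)
  open RingProperties (CommutativeRing.ring +-*-commutativeRing)
    using (-0#≈0#; -‿involutive; -‿+-comm; -‿distribˡ-*; -‿distribʳ-*; x∙y⁻¹≈ε⇒x≈y)
  open CommutativeSemigroupProperties +-commutativeSemigroup using (interchange)

  -F-def : ∀ a b → a -F b ≡ a - b
  -F-def a b = sym (+-reduceʳ (toℕ a) (p ∸ toℕ b))

  x-y≡0⇒x≡y : ∀ x y → x - y ≡ 0F → x ≡ y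
  x-y≡0⇒x≡y = x∙y⁻¹≈ε⇒x≈y

  x≡y-y⇒x≡0 : ∀ {x} y → x ≡ y - y → x ≡ 0F
  x≡y-y⇒x≡0 y x≡y-y = trans x≡y-y (-‿inverseʳ y)

  -‿≢0 : ∀ a → a ≢ 0F → - a ≢ 0F
  -‿≢0 a a≢0 -a≡0 = a≢0 (trans (sym (-‿involutive a)) (trans (cong -_ -a≡0) -0#≈0#))

  -- The ring solver normalises polynomials with integer coefficients: in F itself the numerals do
  -- not compute, p being a variable.

  fromℤ : ℤ → F
  fromℤ (ℤ.+ n)   = fromℕ n
  fromℤ -[1+ n ]  = - fromℕ (suc n)

  fromℤ-neg : ∀ i → fromℤ (ℤ.- i) ≡ - fromℤ i
  fromℤ-neg (ℤ.+ zero)  = sym -0#≈0#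
  fromℤ-neg (ℤ.+ suc n) = refl
  fromℤ-neg -[1+ n ]    = sym (-‿involutive (fromℕ (suc n)))

  1+a-[1+b]≡a-b : ∀ a b → (1F + a) - (1F + b) ≡ a - b
  1+a-[1+b]≡a-b a b = begin
    (1F + a) - (1F + b)          ≡⟨ cong ((1F + a) +_) (-‿+-comm 1F b) ⟨
    (1F + a) + (- 1F + - b)      ≡⟨ interchange 1F a (- 1F) (- b) ⟩
    (1F - 1F) + (a - b)          ≡⟨ cong (_+ (a - b)) (-‿inverseʳ 1F) ⟩
    0F + (a - b)                 ≡⟨ +-identityˡ (a - b) ⟩
    a - b                        ∎

  fromℤ-⊖ : ∀ m n → fromℤ (m ⊖ n) ≡ fromℕ m - fromℕ n
  fromℤ-⊖ m       zero    = sym (trans (cong (fromℕ m +_) -0#≈0#) (+-identityʳ (fromℕ m)))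
  fromℤ-⊖ zero    (suc n) = sym (+-identityˡ (- fromℕ (suc n)))
  fromℤ-⊖ (suc m) (suc n) = begin
    fromℤ (suc m ⊖ suc n)                ≡⟨ cong fromℤ (ℤ.[1+m]⊖[1+n]≡m⊖n m n) ⟩
    fromℤ (m ⊖ n)                        ≡⟨ fromℤ-⊖ m n ⟩
    fromℕ m - fromℕ n                    ≡⟨ 1+a-[1+b]≡a-b (fromℕ m) (fromℕ n) ⟨
    (1F + fromℕ m) - (1F + fromℕ n)      ≡⟨ cong₂ _-_ (fromℕ-+ 1 m) (fromℕ-+ 1 n) ⟨
    fromℕ (suc m) - fromℕ (suc n)        ∎

  fromℤ-+ : ∀ i j → fromℤ (i ℤ.+ j) ≡ fromℤ i + fromℤ j
  fromℤ-+ (ℤ.+ m)   (ℤ.+ n)   = fromℕ-+ m n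
  fromℤ-+ (ℤ.+ m)   -[1+ n ]  = fromℤ-⊖ m (suc n)
  fromℤ-+ -[1+ m ]  (ℤ.+ n)   = trans (fromℤ-⊖ n (suc m)) (+-comm (fromℕ n) (- fromℕ (suc m)))
  fromℤ-+ -[1+ m ]  -[1+ n ]  = begin
    - fromℕ (suc (suc (m ℕ.+ n)))          ≡⟨ cong (λ k → - fromℕ (suc k)) (ℕ.+-suc m n) ⟨
    - fromℕ (suc m ℕ.+ suc n)              ≡⟨ cong -_ (fromℕ-+ (suc m) (suc n)) ⟩
    - (fromℕ (suc m) + fromℕ (suc n))      ≡⟨ -‿+-comm (fromℕ (suc m)) (fromℕ (suc n)) ⟨
    - fromℕ (suc m) + - fromℕ (suc n)      ∎

  fromℤ-* : ∀ i j → fromℤ (i ℤ.* j) ≡ fromℤ i * fromℤ j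
  fromℤ-* (ℤ.+ m)   (ℤ.+ n)   = trans (cong fromℤ (ℤ.+◃n≡+n (m ℕ.* n))) (fromℕ-* m n)
  fromℤ-* (ℤ.+ m)   -[1+ n ]  = begin
    fromℤ (Sign.- ℤ.◃ (m ℕ.* suc n))       ≡⟨ cong fromℤ (ℤ.-◃n≡-n (m ℕ.* suc n)) ⟩
    fromℤ (ℤ.- (ℤ.+ (m ℕ.* suc n)))        ≡⟨ fromℤ-neg (ℤ.+ (m ℕ.* suc n)) ⟩
    - fromℕ (m ℕ.* suc n)                  ≡⟨ cong -_ (fromℕ-* m (suc n)) ⟩
    - (fromℕ m * fromℕ (suc n))            ≡⟨ -‿distribʳ-* (fromℕ m) (fromℕ (suc n)) ⟩
    fromℕ m * - fromℕ (suc n)              ∎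
  fromℤ-* -[1+ m ]  (ℤ.+ n)   = begin
    fromℤ (Sign.- ℤ.◃ (suc m ℕ.* n))       ≡⟨ cong fromℤ (ℤ.-◃n≡-n (suc m ℕ.* n)) ⟩
    fromℤ (ℤ.- (ℤ.+ (suc m ℕ.* n)))        ≡⟨ fromℤ-neg (ℤ.+ (suc m ℕ.* n)) ⟩
    - fromℕ (suc m ℕ.* n)                  ≡⟨ cong -_ (fromℕ-* (suc m) n) ⟩
    - (fromℕ (suc m) * fromℕ n)            ≡⟨ -‿distribˡ-* (fromℕ (suc m)) (fromℕ n) ⟩
    - fromℕ (suc m) * fromℕ n              ∎
  fromℤ-* -[1+ m ]  -[1+ n ]  = begin
    fromℕ (suc m ℕ.* suc n)                ≡⟨ fromℕ-* (suc m) (suc n) ⟩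
    a * b                                  ≡⟨ -‿involutive (a * b) ⟨
    - - (a * b)                            ≡⟨ cong -_ (-‿distribˡ-* a b) ⟩
    - (- a * b)                            ≡⟨ -‿distribʳ-* (- a) b ⟩
    - a * - b                              ∎
    where a = fromℕ (suc m); b = fromℕ (suc n)

  fromℤ-homomorphism : ℤ.+-*-rawRing ACR.-Raw-AlmostCommutative⟶ ACR.fromCommutativeRing +-*-commutativeRing
  fromℤ-homomorphism = record
    { ⟦_⟧    = fromℤ
    ; +-homo = fromℤ-+
    ; *-homo = fromℤ-*
    ; -‿homo = fromℤ-neg
    ; 0-homo = refl
    ; 1-homo = refl
    }

  fromℤ-≟ : ∀ i j → Maybe (fromℤ i ≡ fromℤ j)
  fromℤ-≟ i j with i ℤ.≟ j
  ... | yes i≡j = just (cong fromℤ i≡j)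
  ... | no  _   = nothing

  module RingSolver = Algebra.Solver.Ring ℤ.+-*-rawRing (ACR.fromCommutativeRing +-*-commutativeRing) fromℤ-homomorphism fromℤ-≟
  open RingSolver using (solve; _:=_; _:+_; _:*_; _:-_; :-_; con)

  modulo-det : ∀ {E} R k {D} → E ≡ R + k * (1F - D) → D ≡ 1F → E ≡ R
  modulo-det R k E≡ D≡1 = trans E≡ (trans (cong (λ D → R + k * (1F - D)) D≡1) (vanish R k))
    where vanish = solve 2 (λ r k → r :+ k :* (con 1ℤ :- con 1ℤ) := r) refl

  -- 2×2 matrices

  -- Defs computes det with `_-F_`, on representatives in ℕ; the solver needs the ring's `_-_`
  det-mat : ∀ a b c d → det (mat a b c d) ≡ a * d - b * c
  det-mat a b c d = -F-def (a * d) (b * c)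

  mat-≡ : ∀ {a b c d a′ b′ c′ d′} → a ≡ a′ → b ≡ b′ → c ≡ c′ → d ≡ d′ → mat a b c d ≡ mat a′ b′ c′ d′
  mat-≡ refl refl refl refl = refl

  2F : F
  2F = 1F + 1F

  trace : M2 → F
  trace (mat a _ _ d) = a + d

  scalar : F → M2
  scalar s = mat s 0F 0F s

  -I : M2
  -I = scalar (- 1F)

  upper lower : F → M2
  upper t = mat 1F t 0F 1F
  lower t = mat 1F 0F t 1F

  ·-assoc : ∀ A B C → (A · B) · C ≡ A · (B · C)
  ·-assoc (mat a b c d) (mat e f g h) (mat i j k l) =
    mat-≡ (entry a b i k) (entry a b j l) (entry c d i k) (entry c d j l)
    where
    entry : ∀ a b i k → (a * e + b * g) * i + (a * f + b * h) * k ≡ a * (e * i + f * k) + b * (g * i + h * k)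
    entry = solve 8 (λ e f g h a b i k → (a :* e :+ b :* g) :* i :+ (a :* f :+ b :* h) :* k
                                       := a :* (e :* i :+ f :* k) :+ b :* (g :* i :+ h :* k)) refl e f g h

  ·-identityˡ : ∀ A → I · A ≡ A
  ·-identityˡ (mat a b c d) = mat-≡ (1x+0y a c) (1x+0y b d) (0x+1y a c) (0x+1y b d)
    where
    1x+0y = solve 2 (λ x y → con 1ℤ :* x :+ con 0ℤ :* y := x) refl
    0x+1y = solve 2 (λ x y → con 0ℤ :* x :+ con 1ℤ :* y := y) refl

  ·-identityʳ : ∀ A → A · I ≡ A
  ·-identityʳ (mat a b c d) = mat-≡ (x1+y0 a b) (x0+y1 a b) (x1+y0 c d) (x0+y1 c d)
    where
    x1+y0 = solve 2 (λ x y → x :* con 1ℤ :+ y :* con 0ℤ := x) refl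
    x0+y1 = solve 2 (λ x y → x :* con 0ℤ :+ y :* con 1ℤ := y) refl

  det-· : ∀ A B → det (A · B) ≡ det A * det B
  det-· (mat a b c d) (mat e f g h) = begin
    det (mat a b c d · mat e f g h)
      ≡⟨ det-mat (a * e + b * g) (a * f + b * h) (c * e + d * g) (c * f + d * h) ⟩
    (a * e + b * g) * (c * f + d * h) - (a * f + b * h) * (c * e + d * g)
      ≡⟨ solve 8 (λ a b c d e f g h → (a :* e :+ b :* g) :* (c :* f :+ d :* h) :- (a :* f :+ b :* h) :* (c :* e :+ d :* g)
                                     := (a :* d :- b :* c) :* (e :* h :- f :* g)) refl a b c d e f g h ⟩
    (a * d - b * c) * (e * h - f * g)
      ≡⟨ cong₂ _*_ (det-mat a b c d) (det-mat e f g h) ⟨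
    det (mat a b c d) * det (mat e f g h)
      ∎

  scalar-· : ∀ s t → scalar s · scalar t ≡ scalar (s * t)
  scalar-· s t = mat-≡ (e₁₁ s t) (e₁₂ s t) (e₂₁ s t) (e₂₂ s t)
    where
    e₁₁ = solve 2 (λ s t → s :* t :+ con 0ℤ :* con 0ℤ := s :* t) refl
    e₁₂ = solve 2 (λ s t → s :* con 0ℤ :+ con 0ℤ :* t := con 0ℤ) refl
    e₂₁ = solve 2 (λ s t → con 0ℤ :* t :+ s :* con 0ℤ := con 0ℤ) refl
    e₂₂ = solve 2 (λ s t → con 0ℤ :* con 0ℤ :+ s :* t := s :* t) refl

  scalar-comm : ∀ s A → scalar s · A ≡ A · scalar s
  scalar-comm s (mat a b c d) = mat-≡ (e₁₁ s a b c) (e₁₂ s a b d) (e₂₁ s a c d) (e₂₂ s b c d)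
    where
    e₁₁ = solve 4 (λ s a b c → s :* a :+ con 0ℤ :* c := a :* s :+ b :* con 0ℤ) refl
    e₁₂ = solve 4 (λ s a b d → s :* b :+ con 0ℤ :* d := a :* con 0ℤ :+ b :* s) refl
    e₂₁ = solve 4 (λ s a c d → con 0ℤ :* a :+ s :* c := c :* s :+ d :* con 0ℤ) refl
    e₂₂ = solve 4 (λ s b c d → con 0ℤ :* b :+ s :* d := c :* con 0ℤ :+ d :* s) refl

  -I·-I≡I : -I · -I ≡ I
  -I·-I≡I = trans (scalar-· (- 1F) (- 1F)) (cong scalar (solve 0 (:- con 1ℤ :* :- con 1ℤ := con 1ℤ) refl))

  ·-adjugate : ∀ A → A · inv A ≡ scalar (det A)
  ·-adjugate (mat a b c d) = trans (mat-≡ (e₁₁ a b c d) (e₁₂ a b) (e₂₁ c d) (e₂₂ a b c d)) (sym (cong scalar (det-mat a b c d)))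
    where
    e₁₁ = solve 4 (λ a b c d → a :* d :+ b :* :- c := a :* d :- b :* c) refl
    e₁₂ = solve 2 (λ a b → a :* :- b :+ b :* a := con 0ℤ) refl
    e₂₁ = solve 2 (λ c d → c :* d :+ d :* :- c := con 0ℤ) refl
    e₂₂ = solve 4 (λ a b c d → c :* :- b :+ d :* a := a :* d :- b :* c) refl

  adjugate-· : ∀ A → inv A · A ≡ scalar (det A)
  adjugate-· (mat a b c d) = trans (mat-≡ (e₁₁ a b c d) (e₁₂ b d) (e₂₁ a c) (e₂₂ a b c d)) (sym (cong scalar (det-mat a b c d)))
    where
    e₁₁ = solve 4 (λ a b c d → d :* a :+ :- b :* c := a :* d :- b :* c) refl
    e₁₂ = solve 2 (λ b d → d :* b :+ :- b :* d := con 0ℤ) refl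
    e₂₁ = solve 2 (λ a c → :- c :* a :+ a :* c := con 0ℤ) refl
    e₂₂ = solve 4 (λ a b c d → :- c :* b :+ a :* d := a :* d :- b :* c) refl

  upper-· : ∀ s t → upper s · upper t ≡ upper (s + t)
  upper-· s t = mat-≡ (e₁₁ s t) (e₁₂ s t) (e₂₁ s t) (e₂₂ s t)
    where
    e₁₁ = solve 2 (λ s t → con 1ℤ :* con 1ℤ :+ s :* con 0ℤ := con 1ℤ) refl
    e₁₂ = solve 2 (λ s t → con 1ℤ :* t :+ s :* con 1ℤ := s :+ t) refl
    e₂₁ = solve 2 (λ s t → con 0ℤ :* con 1ℤ :+ con 1ℤ :* con 0ℤ := con 0ℤ) refl
    e₂₂ = solve 2 (λ s t → con 0ℤ :* t :+ con 1ℤ :* con 1ℤ := con 1ℤ) refl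

  lower-· : ∀ s t → lower s · lower t ≡ lower (s + t)
  lower-· s t = mat-≡ (e₁₁ s t) (e₁₂ s t) (e₂₁ s t) (e₂₂ s t)
    where
    e₁₁ = solve 2 (λ s t → con 1ℤ :* con 1ℤ :+ con 0ℤ :* t := con 1ℤ) refl
    e₁₂ = solve 2 (λ s t → con 1ℤ :* con 0ℤ :+ con 0ℤ :* con 1ℤ := con 0ℤ) refl
    e₂₁ = solve 2 (λ s t → s :* con 1ℤ :+ con 1ℤ :* t := s :+ t) refl
    e₂₂ = solve 2 (λ s t → s :* con 0ℤ :+ con 1ℤ :* con 1ℤ := con 1ℤ) refl

  lower-comm : ∀ s t → lower s · lower t ≡ lower t · lower s
  lower-comm s t = trans (lower-· s t) (trans (cong lower (+-comm s t)) (sym (lower-· t s)))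

  SL-I : SL I
  SL-I = trans (det-mat 1F 0F 0F 1F) (solve 0 (con 1ℤ :* con 1ℤ :- con 0ℤ :* con 0ℤ := con 1ℤ) refl)

  SL--I : SL -I
  SL--I = trans (det-mat (- 1F) 0F 0F (- 1F)) (solve 0 (:- con 1ℤ :* :- con 1ℤ :- con 0ℤ :* con 0ℤ := con 1ℤ) refl)

  SL-upper : ∀ t → SL (upper t)
  SL-upper t = trans (det-mat 1F t 0F 1F) (solve 1 (λ t → con 1ℤ :* con 1ℤ :- t :* con 0ℤ := con 1ℤ) refl t)

  SL-lower : ∀ t → SL (lower t)
  SL-lower t = trans (det-mat 1F 0F t 1F) (solve 1 (λ t → con 1ℤ :* con 1ℤ :- con 0ℤ :* t := con 1ℤ) refl t)

  SL-· : ∀ A B → SL A → SL B → SL (A · B)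
  SL-· A B sA sB = trans (det-· A B) (trans (cong₂ _*_ sA sB) (*-identityˡ 1F))

  ·-inverseʳ : ∀ A → SL A → A · inv A ≡ I
  ·-inverseʳ A sA = trans (·-adjugate A) (cong scalar sA)

  ·-inverseˡ : ∀ A → SL A → inv A · A ≡ I
  ·-inverseˡ A sA = trans (adjugate-· A) (cong scalar sA)

  ·-cancelʳ : ∀ A B C → SL C → A · C ≡ B · C → A ≡ B
  ·-cancelʳ A B C sC AC≡BC = begin
    A                  ≡⟨ ·-identityʳ A ⟨
    A · I              ≡⟨ cong (A ·_) (·-inverseʳ C sC) ⟨
    A · (C · inv C)    ≡⟨ ·-assoc A C (inv C) ⟨
    (A · C) · inv C    ≡⟨ cong (_· inv C) AC≡BC ⟩
    (B · C) · inv C    ≡⟨ ·-assoc B C (inv C) ⟩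
    B · (C · inv C)    ≡⟨ cong (B ·_) (·-inverseʳ C sC) ⟩
    B · I              ≡⟨ ·-identityʳ B ⟩
    B                  ∎

  ·-cancelˡ : ∀ A B C → SL C → C · A ≡ C · B → A ≡ B
  ·-cancelˡ A B C sC CA≡CB = begin
    A                  ≡⟨ ·-identityˡ A ⟨
    I · A              ≡⟨ cong (_· A) (·-inverseˡ C sC) ⟨
    (inv C · C) · A    ≡⟨ ·-assoc (inv C) C A ⟩
    inv C · (C · A)    ≡⟨ cong (inv C ·_) CA≡CB ⟩
    inv C · (C · B)    ≡⟨ ·-assoc (inv C) C B ⟨
    (inv C · C) · B    ≡⟨ cong (_· B) (·-inverseˡ C sC) ⟩
    I · B              ≡⟨ ·-identityˡ B ⟩
    B                  ∎

  Central-scalar : ∀ s → SL (scalar s) → Central (scalar s)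
  Central-scalar s ss = ss , λ h _ → scalar-comm s h

  pow-SL : ∀ g n → SL g → SL (pow g n)
  pow-SL g zero    sg = SL-I
  pow-SL g (suc n) sg = SL-· (pow g n) g (pow-SL g n sg) sg

  pow-+ : ∀ g m n → pow g (m ℕ.+ n) ≡ pow g m · pow g n
  pow-+ g m zero    = trans (cong (pow g) (ℕ.+-identityʳ m)) (sym (·-identityʳ (pow g m)))
  pow-+ g m (suc n) = begin
    pow g (m ℕ.+ suc n)        ≡⟨ cong (pow g) (ℕ.+-suc m n) ⟩
    pow g (m ℕ.+ n) · g        ≡⟨ cong (_· g) (pow-+ g m n) ⟩
    (pow g m · pow g n) · g    ≡⟨ ·-assoc (pow g m) (pow g n) g ⟩
    pow g m · pow g (suc n)    ∎

  pow-I : ∀ n → pow I n ≡ I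
  pow-I zero    = refl
  pow-I (suc n) = trans (cong (_· I) (pow-I n)) (·-identityʳ I)

  pow-* : ∀ g m n → pow g (m ℕ.* n) ≡ pow (pow g m) n
  pow-* g m zero    = cong (pow g) (ℕ.*-zeroʳ m)
  pow-* g m (suc n) = begin
    pow g (m ℕ.* suc n)          ≡⟨ cong (pow g) (trans (ℕ.*-suc m n) (ℕ.+-comm m (m ℕ.* n))) ⟩
    pow g (m ℕ.* n ℕ.+ m)        ≡⟨ pow-+ g (m ℕ.* n) m ⟩
    pow g (m ℕ.* n) · pow g m    ≡⟨ cong (_· pow g m) (pow-* g m n) ⟩
    pow (pow g m) (suc n)        ∎

  pow-4 : ∀ M → pow M 4 ≡ (M · M) · (M · M)
  pow-4 M = trans (pow-+ M 2 2) (cong₂ _·_ square square)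
    where square = cong (_· M) (·-identityˡ M)

  pow-bM : ∀ n → pow bM n ≡ lower (fromℕ n)
  pow-bM zero    = refl
  pow-bM (suc n) = begin
    pow bM n · bM                 ≡⟨ cong (_· bM) (pow-bM n) ⟩
    lower (fromℕ n) · lower 1F    ≡⟨ lower-· (fromℕ n) 1F ⟩
    lower (fromℕ n + 1F)          ≡⟨ cong lower (trans (+-comm (fromℕ n) 1F) (sym (fromℕ-+ 1 n))) ⟩
    lower (fromℕ (suc n))         ∎

  pow-wM : ∀ n → pow wM n ≡ upper (fromℕ n)
  pow-wM zero    = refl
  pow-wM (suc n) = begin
    pow wM n · wM                 ≡⟨ cong (_· wM) (pow-wM n) ⟩
    upper (fromℕ n) · upper 1F    ≡⟨ upper-· (fromℕ n) 1F ⟩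
    upper (fromℕ n + 1F)          ≡⟨ cong upper (trans (+-comm (fromℕ n) 1F) (sym (fromℕ-+ 1 n))) ⟩
    upper (fromℕ (suc n))         ∎

  infixl 6 _+ᴹ_
  _+ᴹ_ : M2 → M2 → M2
  mat a b c d +ᴹ mat e f g h = mat (a + e) (b + f) (c + g) (d + h)

  -ᴹ_ : M2 → M2
  -ᴹ mat a b c d = mat (- a) (- b) (- c) (- d)

  0ᴹ : M2
  0ᴹ = scalar 0F

  +ᴹ-assoc : ∀ A B C → (A +ᴹ B) +ᴹ C ≡ A +ᴹ (B +ᴹ C)
  +ᴹ-assoc (mat a b c d) (mat e f g h) (mat i j k l) = mat-≡ (+-assoc a e i) (+-assoc b f j) (+-assoc c g k) (+-assoc d h l)

  +ᴹ-comm : ∀ A B → A +ᴹ B ≡ B +ᴹ A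
  +ᴹ-comm (mat a b c d) (mat e f g h) = mat-≡ (+-comm a e) (+-comm b f) (+-comm c g) (+-comm d h)

  +ᴹ-identityˡ : ∀ A → 0ᴹ +ᴹ A ≡ A
  +ᴹ-identityˡ (mat a b c d) = mat-≡ (+-identityˡ a) (+-identityˡ b) (+-identityˡ c) (+-identityˡ d)

  -ᴹ-inverseˡ : ∀ A → (-ᴹ A) +ᴹ A ≡ 0ᴹ
  -ᴹ-inverseˡ (mat a b c d) = mat-≡ (-‿inverseˡ a) (-‿inverseˡ b) (-‿inverseˡ c) (-‿inverseˡ d)

  ·-distribˡ : ∀ A B C → A · (B +ᴹ C) ≡ A · B +ᴹ A · C
  ·-distribˡ (mat a b c d) (mat e f g h) (mat i j k l) =
    mat-≡ (entry a b e g i k) (entry a b f h j l) (entry c d e g i k) (entry c d f h j l)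
    where
    entry = solve 6 (λ a b e g i k → a :* (e :+ i) :+ b :* (g :+ k) := (a :* e :+ b :* g) :+ (a :* i :+ b :* k)) refl

  ·-distribʳ : ∀ A B C → (B +ᴹ C) · A ≡ B · A +ᴹ C · A
  ·-distribʳ (mat a b c d) (mat e f g h) (mat i j k l) =
    mat-≡ (entry a c e f i j) (entry b d e f i j) (entry a c g h k l) (entry b d g h k l)
    where
    entry = solve 6 (λ a c e f i j → (e :+ i) :* a :+ (f :+ j) :* c := (e :* a :+ f :* c) :+ (i :* a :+ j :* c)) refl

  +ᴹ-·-isRing : IsRing _≡_ _+ᴹ_ _·_ -ᴹ_ 0ᴹ I
  +ᴹ-·-isRing = record
    { +-isAbelianGroup = record
      { isGroup = record
        { isMonoid = record
          { isSemigroup = record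
            { isMagma = record { isEquivalence = isEquivalence ; ∙-cong = cong₂ _+ᴹ_ }
            ; assoc = +ᴹ-assoc }
          ; identity = +ᴹ-identityˡ , λ A → trans (+ᴹ-comm A 0ᴹ) (+ᴹ-identityˡ A) }
        ; inverse = -ᴹ-inverseˡ , λ A → trans (+ᴹ-comm A (-ᴹ A)) (-ᴹ-inverseˡ A)
        ; ⁻¹-cong = cong -ᴹ_ }
      ; comm = +ᴹ-comm }
    ; *-cong = cong₂ _·_
    ; *-assoc = ·-assoc
    ; *-identity = ·-identityˡ , ·-identityʳ
    ; distrib = ·-distribˡ , ·-distribʳ }

  +ᴹ-·-ring : Ring _ _
  +ᴹ-·-ring = record { isRing = +ᴹ-·-isRing }

  open RingProperties +ᴹ-·-ring using () renaming (+-cancelˡ to +ᴹ-cancelˡ)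
  open Ring +ᴹ-·-ring using () renaming (+-identityʳ to +ᴹ-identityʳ)
  open import Algebra.Properties.Semiring.Exp (Ring.semiring +ᴹ-·-ring) using (_^_)
  open import Algebra.Properties.Semiring.Mult (Ring.semiring +ᴹ-·-ring) using () renaming (_×_ to _×ₙ_)

  ^≡pow : ∀ A n → A ^ n ≡ pow A n
  ^≡pow A zero    = refl
  ^≡pow A (suc n) = begin
    A · (A ^ n)          ≡⟨ cong (A ·_) (^≡pow A n) ⟩
    A · pow A n          ≡⟨ cong (_· pow A n) (·-identityˡ A) ⟨
    pow A 1 · pow A n    ≡⟨ pow-+ A 1 n ⟨
    pow A (suc n)        ∎

  ×ₙ-I : ∀ n → n ×ₙ I ≡ scalar (fromℕ n)
  ×ₙ-I zero    = refl
  ×ₙ-I (suc n) = begin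
    I +ᴹ (n ×ₙ I)            ≡⟨ cong (I +ᴹ_) (×ₙ-I n) ⟩
    I +ᴹ scalar (fromℕ n)    ≡⟨ mat-≡ (sym (fromℕ-+ 1 n)) (+-identityˡ 0F) (+-identityˡ 0F) (sym (fromℕ-+ 1 n)) ⟩
    scalar (fromℕ (suc n))   ∎

  det-0ᴹ : det 0ᴹ ≡ 0F
  det-0ᴹ = trans (det-mat 0F 0F 0F 0F) (solve 0 (con 0ℤ :* con 0ℤ :- con 0ℤ :* con 0ℤ := con 0ℤ) refl)

  cayley-hamilton : ∀ M → M · M ≡ mat (M2.a M * trace M - det M) (M2.b M * trace M) (M2.c M * trace M) (M2.d M * trace M - det M)
  cayley-hamilton (mat a b c d) =
    trans (mat-≡ (e₁₁ a b c d) (e₁₂ a b d) (e₂₁ a c d) (e₂₂ a b c d))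
          (cong (λ δ → mat (a * (a + d) - δ) (b * (a + d)) (c * (a + d)) (d * (a + d) - δ)) (sym (det-mat a b c d)))
    where
    e₁₁ = solve 4 (λ a b c d → a :* a :+ b :* c := a :* (a :+ d) :- (a :* d :- b :* c)) refl
    e₁₂ = solve 3 (λ a b d → a :* b :+ b :* d := b :* (a :+ d)) refl
    e₂₁ = solve 3 (λ a c d → c :* a :+ d :* c := c :* (a :+ d)) refl
    e₂₂ = solve 4 (λ a b c d → c :* b :+ d :* d := d :* (a :+ d) :- (a :* d :- b :* c)) refl

  traceless⇒square≡-I : ∀ M → SL M → trace M ≡ 0F → M · M ≡ -I
  traceless⇒square≡-I M@(mat a b c d) sM tr≡0 = begin
    M · M
      ≡⟨ cayley-hamilton M ⟩
    mat (a * (a + d) - det M) (b * (a + d)) (c * (a + d)) (d * (a + d) - det M)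
      ≡⟨ cong₂ (λ t δ → mat (a * t - δ) (b * t) (c * t) (d * t - δ)) tr≡0 sM ⟩
    mat (a * 0F - 1F) (b * 0F) (c * 0F) (d * 0F - 1F)
      ≡⟨ mat-≡ (x0-1 a) (zeroʳ b) (zeroʳ c) (x0-1 d) ⟩
    -I
      ∎
    where x0-1 = solve 1 (λ x → x :* con 0ℤ :- con 1ℤ := :- con 1ℤ) refl

  -- Dessin isomorphisms

  Intertwines : (M2 → M2) → M2 → M2 → Set
  Intertwines f A A′ = ∀ g → SL g → f (A · g) ≡ A′ · f g

  intertwines-· : ∀ {f} A B A′ B′ → SL B → Intertwines f A A′ → Intertwines f B B′ → Intertwines f (A · B) (A′ · B′)
  intertwines-· {f} A B A′ B′ sB fA fB g sg = begin
    f ((A · B) · g)      ≡⟨ cong f (·-assoc A B g) ⟩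
    f (A · (B · g))      ≡⟨ fA (B · g) (SL-· B g sB sg) ⟩
    A′ · f (B · g)       ≡⟨ cong (A′ ·_) (fB g sg) ⟩
    A′ · (B′ · f g)      ≡⟨ ·-assoc A′ B′ (f g) ⟨
    (A′ · B′) · f g      ∎

  intertwines-pow : ∀ {f} A A′ → SL A → Intertwines f A A′ → ∀ n → Intertwines f (pow A n) (pow A′ n)
  intertwines-pow {f} A A′ sA fA zero    g sg = trans (cong f (·-identityˡ g)) (sym (·-identityˡ (f g)))
  intertwines-pow {f} A A′ sA fA (suc n) = intertwines-· (pow A n) A (pow A′ n) A′ sA (intertwines-pow A A′ sA fA n) fA

  intertwines-≡I : ∀ {f} A A′ → SL (f I) → Intertwines f A A′ → A ≡ I → A′ ≡ I
  intertwines-≡I {f} A A′ sfI fA refl = ·-cancelʳ A′ I (f I) sfI (begin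
    A′ · f I     ≡⟨ fA I SL-I ⟨
    f (I · I)    ≡⟨ cong f (·-identityˡ I) ⟩
    f I          ≡⟨ ·-identityˡ (f I) ⟨
    I · f I      ∎)

  intertwines-pow-≡I : ∀ {f} A A′ → SL A → SL (f I) → Intertwines f A A′ → ∀ n → pow A n ≡ I → pow A′ n ≡ I
  intertwines-pow-≡I A A′ sA sfI fA n = intertwines-≡I (pow A n) (pow A′ n) sfI (intertwines-pow A A′ sA fA n)

  DessinIso-sym : ∀ {x y x′ y′} → SL x → SL y → DessinIso x y x′ y′ → DessinIso x′ y′ x y
  DessinIso-sym {x} {y} {x′} {y′} sx sy (f , (fSL , h , hSL , hf , fh) , fx , fy) =
    h , (hSL , f , fSL , fh , hf) , inverse-intertwines x x′ sx fx , inverse-intertwines y y′ sy fy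
    where
    inverse-intertwines : ∀ z z′ → SL z → Intertwines f z z′ → Intertwines h z′ z
    inverse-intertwines z z′ sz fz g sg = begin
      h (z′ · g)           ≡⟨ cong (λ u → h (z′ · u)) (fh g sg) ⟨
      h (z′ · f (h g))     ≡⟨ cong h (fz (h g) (hSL g sg)) ⟨
      h (f (z · h g))      ≡⟨ hf (z · h g) (SL-· z (h g) sz (hSL g sg)) ⟩
      z · h g              ∎

  DessinIso-trans : ∀ {x y x′ y′ x″ y″} → DessinIso x y x′ y′ → DessinIso x′ y′ x″ y″ → DessinIso x y x″ y″
  DessinIso-trans (f , (fSL , h , hSL , hf , fh) , fx , fy) (f′ , (fSL′ , h′ , hSL′ , hf′ , fh′) , fx′ , fy′) =
    (λ g → f′ (f g)) ,
    ((λ g sg → fSL′ (f g) (fSL g sg)) , (λ g → h (h′ g)) , (λ g sg → hSL (h′ g) (hSL′ g sg)) ,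
     (λ g sg → trans (cong h (hf′ (f g) (fSL g sg))) (hf g sg)) ,
     (λ g sg → trans (cong f′ (fh (h′ g) (hSL′ g sg))) (fh′ g sg))) ,
    (λ g sg → trans (cong f′ (fx g sg)) (fx′ (f g) (fSL g sg))) ,
    (λ g sg → trans (cong f′ (fy g sg)) (fy′ (f g) (fSL g sg)))

  DessinIso-HasOrder-xy : ∀ {x y x′ y′ n} → SL x → SL y → SL x′ → SL y′ → DessinIso x y x′ y′ →
                          HasOrder (x · y) n → HasOrder (x′ · y′) n
  DessinIso-HasOrder-xy {x} {y} {x′} {y′} {n} sx sy sx′ sy′ iso (0<n , xyⁿ≡I , minimal) =
    0<n , transport x y x′ y′ iso sx sy n xyⁿ≡I ,
    λ m 0<m m<n x′y′ᵐ≡I → minimal m 0<m m<n (transport x′ y′ x y iso⁻¹ sx′ sy′ m x′y′ᵐ≡I)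
    where
    iso⁻¹ = DessinIso-sym {x} {y} {x′} {y′} sx sy iso
    transport : ∀ x y x′ y′ → DessinIso x y x′ y′ → SL x → SL y → ∀ k → pow (x · y) k ≡ I → pow (x′ · y′) k ≡ I
    transport x y x′ y′ (f , (fSL , _) , fx , fy) sx sy =
      intertwines-pow-≡I {f} (x · y) (x′ · y′) (SL-· x y sx sy) (fSL I SL-I) (intertwines-· x y x′ y′ sy fx fy)

  ·-monoid : Monoid _ _
  ·-monoid = record
    { isMonoid = record
      { isSemigroup = record
        { isMagma = record { isEquivalence = isEquivalence ; ∙-cong = cong₂ _·_ }
        ; assoc = ·-assoc }
      ; identity = ·-identityˡ , ·-identityʳ } }

  module MonoidSolver = Algebra.Solver.Monoid ·-monoid
  open MonoidSolver using (_⊕_; _⊜_)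

  conj : M2 → M2 → M2 → M2
  conj P⁻¹ P g = (P⁻¹ · g) · P

  SL-conj : ∀ Q R → Q · R ≡ I → ∀ g → SL g → SL (conj Q R g)
  SL-conj Q R QR≡I g sg = begin
    det ((Q · g) · R)          ≡⟨ det-· (Q · g) R ⟩
    det (Q · g) * det R        ≡⟨ cong (_* det R) (det-· Q g) ⟩
    det Q * det g * det R      ≡⟨ cong (λ u → det Q * u * det R) sg ⟩
    det Q * 1F * det R         ≡⟨ cong (_* det R) (*-identityʳ (det Q)) ⟩
    det Q * det R              ≡⟨ det-· Q R ⟨
    det (Q · R)                ≡⟨ cong det QR≡I ⟩
    det I                      ≡⟨ SL-I ⟩
    1F                         ∎

  conj-conj : ∀ Q R g → Q · R ≡ I → conj Q R (conj R Q g) ≡ g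
  conj-conj Q R g QR≡I = begin
    (Q · ((R · g) · Q)) · R
      ≡⟨ MonoidSolver.solve 3 (λ q r g → (q ⊕ ((r ⊕ g) ⊕ q)) ⊕ r ⊜ ((q ⊕ r) ⊕ g) ⊕ (q ⊕ r)) refl Q R g ⟩
    ((Q · R) · g) · (Q · R)
      ≡⟨ cong₂ (λ u v → (u · g) · v) QR≡I QR≡I ⟩
    (I · g) · I
      ≡⟨ trans (·-identityʳ (I · g)) (·-identityˡ g) ⟩
    g
      ∎

  conj-· : ∀ P P⁻¹ g h → P · P⁻¹ ≡ I → conj P⁻¹ P (g · h) ≡ conj P⁻¹ P g · conj P⁻¹ P h
  conj-· P P⁻¹ g h PP⁻¹≡I = begin
    (P⁻¹ · (g · h)) · P
      ≡⟨ MonoidSolver.solve 4 (λ a g h b → (a ⊕ (g ⊕ h)) ⊕ b ⊜ ((a ⊕ g) ⊕ h) ⊕ b) refl P⁻¹ g h P ⟩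
    ((P⁻¹ · g) · h) · P
      ≡⟨ cong (λ u → ((P⁻¹ · g) · u) · P) (trans (cong (_· h) PP⁻¹≡I) (·-identityˡ h)) ⟨
    ((P⁻¹ · g) · ((P · P⁻¹) · h)) · P
      ≡⟨ MonoidSolver.solve 5 (λ a g b a′ h → ((a ⊕ g) ⊕ ((b ⊕ a′) ⊕ h)) ⊕ b ⊜ ((a ⊕ g) ⊕ b) ⊕ ((a′ ⊕ h) ⊕ b)) refl P⁻¹ g P P⁻¹ h ⟩
    ((P⁻¹ · g) · P) · ((P⁻¹ · h) · P)
      ∎

  conj-I : ∀ P P⁻¹ → P⁻¹ · P ≡ I → conj P⁻¹ P I ≡ I
  conj-I P P⁻¹ P⁻¹P≡I = trans (cong (_· P) (·-identityʳ P⁻¹)) P⁻¹P≡I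

  conj-scalar : ∀ P P⁻¹ s → P⁻¹ · P ≡ I → conj P⁻¹ P (scalar s) ≡ scalar s
  conj-scalar P P⁻¹ s P⁻¹P≡I = begin
    (P⁻¹ · scalar s) · P     ≡⟨ cong (_· P) (scalar-comm s P⁻¹) ⟨
    (scalar s · P⁻¹) · P     ≡⟨ ·-assoc (scalar s) P⁻¹ P ⟩
    scalar s · (P⁻¹ · P)     ≡⟨ cong (scalar s ·_) P⁻¹P≡I ⟩
    scalar s · I             ≡⟨ ·-identityʳ (scalar s) ⟩
    scalar s                 ∎

  intertwiner⇒conj≡ : ∀ P P⁻¹ x x′ → P⁻¹ · P ≡ I → x · P ≡ P · x′ → conj P⁻¹ P x ≡ x′
  intertwiner⇒conj≡ P P⁻¹ x x′ P⁻¹P≡I xP≡Px′ = begin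
    (P⁻¹ · x) · P       ≡⟨ ·-assoc P⁻¹ x P ⟩
    P⁻¹ · (x · P)       ≡⟨ cong (P⁻¹ ·_) xP≡Px′ ⟩
    P⁻¹ · (P · x′)      ≡⟨ ·-assoc P⁻¹ P x′ ⟨
    (P⁻¹ · P) · x′      ≡⟨ cong (_· x′) P⁻¹P≡I ⟩
    I · x′              ≡⟨ ·-identityˡ x′ ⟩
    x′                  ∎

  conj-intertwiner : ∀ P P⁻¹ y → P · P⁻¹ ≡ I → y · P ≡ P · conj P⁻¹ P y
  conj-intertwiner P P⁻¹ y PP⁻¹≡I = begin
    y · P
      ≡⟨ cong (_· P) (trans (cong (_· y) PP⁻¹≡I) (·-identityˡ y)) ⟨
    ((P · P⁻¹) · y) · P
      ≡⟨ MonoidSolver.solve 4 (λ a b y c → ((a ⊕ b) ⊕ y) ⊕ c ⊜ a ⊕ ((b ⊕ y) ⊕ c)) refl P P⁻¹ y P ⟩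
    P · ((P⁻¹ · y) · P)
      ∎

  DessinIso-conj : ∀ P P⁻¹ {x y x′ y′} → P⁻¹ · P ≡ I → P · P⁻¹ ≡ I →
                   x · P ≡ P · x′ → y · P ≡ P · y′ → DessinIso x y x′ y′
  DessinIso-conj P P⁻¹ {x} {y} {x′} {y′} P⁻¹P≡I PP⁻¹≡I xP≡Px′ yP≡Py′ =
    conj P⁻¹ P ,
    (SL-conj P⁻¹ P P⁻¹P≡I , conj P P⁻¹ , SL-conj P P⁻¹ PP⁻¹≡I ,
     (λ g _ → conj-conj P P⁻¹ g PP⁻¹≡I) , (λ g _ → conj-conj P⁻¹ P g P⁻¹P≡I)) ,
    conj-intertwines x x′ xP≡Px′ , conj-intertwines y y′ yP≡Py′
    where
    conj-intertwines : ∀ z z′ → z · P ≡ P · z′ → Intertwines (conj P⁻¹ P) z z′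
    conj-intertwines z z′ zP≡Pz′ g _ = begin
      conj P⁻¹ P (z · g)              ≡⟨ conj-· P P⁻¹ z g PP⁻¹≡I ⟩
      conj P⁻¹ P z · conj P⁻¹ P g     ≡⟨ cong (_· conj P⁻¹ P g) (intertwiner⇒conj≡ P P⁻¹ z z′ P⁻¹P≡I zP≡Pz′) ⟩
      z′ · conj P⁻¹ P g               ∎

  -- Orders

  pow-mod : ∀ g n k .{{_ : NonZero n}} → pow g n ≡ I → pow g k ≡ pow g (k % n)
  pow-mod g n k gⁿ≡I = begin
    pow g k                                  ≡⟨ cong (pow g) (m≡m%n+[m/n]*n k n) ⟩
    pow g (k % n ℕ.+ k / n ℕ.* n)            ≡⟨ pow-+ g (k % n) (k / n ℕ.* n) ⟩
    pow g (k % n) · pow g (k / n ℕ.* n)      ≡⟨ cong (λ m → pow g (k % n) · pow g m) (ℕ.*-comm (k / n) n) ⟩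
    pow g (k % n) · pow g (n ℕ.* (k / n))    ≡⟨ cong (pow g (k % n) ·_) (pow-* g n (k / n)) ⟩
    pow g (k % n) · pow (pow g n) (k / n)    ≡⟨ cong (λ h → pow g (k % n) · pow h (k / n)) gⁿ≡I ⟩
    pow g (k % n) · pow I (k / n)            ≡⟨ cong (pow g (k % n) ·_) (pow-I (k / n)) ⟩
    pow g (k % n) · I                        ≡⟨ ·-identityʳ (pow g (k % n)) ⟩
    pow g (k % n)                            ∎

  pow-∸ : ∀ g {i j} → SL g → i ≤ j → pow g i ≡ pow g j → pow g (j ∸ i) ≡ I
  pow-∸ g {i} {j} sg i≤j gⁱ≡gʲ = ·-cancelʳ (pow g (j ∸ i)) I (pow g i) (pow-SL g i sg) (begin
    pow g (j ∸ i) · pow g i     ≡⟨ pow-+ g (j ∸ i) i ⟨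
    pow g (j ∸ i ℕ.+ i)         ≡⟨ cong (pow g) (ℕ.m∸n+n≡m i≤j) ⟩
    pow g j                     ≡⟨ gⁱ≡gʲ ⟨
    pow g i                     ≡⟨ ·-identityˡ (pow g i) ⟨
    I · pow g i                 ∎)

  HasOrder⇒∣ : ∀ {g n} → HasOrder g n → ∀ k → pow g k ≡ I → n ∣ k
  HasOrder⇒∣ {g} {n} (0<n , gⁿ≡I , minimal) k gᵏ≡I =
    m%n≡0⇒n∣m k n (ℕ.n≤0⇒n≡0 (ℕ.≮⇒≥ λ 0<k%n → minimal (k % n) 0<k%n (m%n<n k n) gᵏ%ⁿ≡I))
    where
    instance _ = ℕ.>-nonZero 0<n
    gᵏ%ⁿ≡I : pow g (k % n) ≡ I
    gᵏ%ⁿ≡I = trans (sym (pow-mod g n k gⁿ≡I)) gᵏ≡I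

  -- pigeonhole on x⁰, …, xᵈ, whose images lie in the d-element coset ⟨z⟩ f(I)
  period-transfer : ∀ x z (f : M2 → M2) → SL x →
    (∀ g g′ → SL g → SL g′ → f g ≡ f g′ → g ≡ g′) →
    (∀ k → SameCoset z (f I) (f (pow x k))) →
    ∀ d → 0 ℕ.< d → pow z d ≡ I → ∃ λ e → 0 ℕ.< e × e ≤ d × pow x e ≡ I
  period-transfer x z f sx f-injective coset d 0<d zᵈ≡I = collision (Fin.pigeonhole (ℕ.n<1+n d) index)
    where
    instance _ = ℕ.>-nonZero 0<d
    index : Fin (suc d) → Fin d
    index k = proj₁ (coset (toℕ k)) mod d
    index-correct : ∀ k → f (pow x (toℕ k)) ≡ pow z (toℕ (index k)) · f I
    index-correct k = begin
      f (pow x (toℕ k))             ≡⟨ proj₂ (coset (toℕ k)) ⟩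
      pow z m · f I                 ≡⟨ cong (_· f I) (pow-mod z d m zᵈ≡I) ⟩
      pow z (m % d) · f I           ≡⟨ cong (λ n → pow z n · f I) (Fin.toℕ-fromℕ< (m%n<n m d)) ⟨
      pow z (toℕ (m mod d)) · f I   ∎
      where m = proj₁ (coset (toℕ k))
    collision : (∃₂ λ i j → i Fin.< j × index i ≡ index j) → ∃ λ e → 0 ℕ.< e × e ≤ d × pow x e ≡ I
    collision (i , j , i<j , same-index) =
      toℕ j ∸ toℕ i , ℕ.m<n⇒0<n∸m i<j , ℕ.≤-trans (ℕ.m∸n≤m (toℕ j) (toℕ i)) (ℕ.≤-pred (Fin.toℕ<n j)) ,
      pow-∸ x sx (ℕ.<⇒≤ i<j) (f-injective (pow x (toℕ i)) (pow x (toℕ j)) (pow-SL x (toℕ i) sx) (pow-SL x (toℕ j) sx) (begin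
        f (pow x (toℕ i))             ≡⟨ index-correct i ⟩
        pow z (toℕ (index i)) · f I   ≡⟨ cong (λ k → pow z (toℕ k) · f I) same-index ⟩
        pow z (toℕ (index j)) · f I   ≡⟨ index-correct j ⟨
        f (pow x (toℕ j))             ∎))

  coset-compatible⇒HasOrder : ∀ x z (f : M2 → M2) → BijectiveOnG f →
    (∀ g h → SL g → SL h → SameCoset x g h ⇔ SameCoset z (f g) (f h)) →
    SL x → SL z → ∀ {n} → HasOrder z n → HasOrder x n
  coset-compatible⇒HasOrder x z f (fSL , f⁻¹ , f⁻¹SL , f⁻¹f , ff⁻¹) compatible sx sz {n} (0<n , zⁿ≡I , z-minimal) =
    0<n , xⁿ≡I , x-minimal
    where
    injective : ∀ (φ ψ : M2 → M2) → (∀ g → SL g → ψ (φ g) ≡ g) →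
                ∀ g g′ → SL g → SL g′ → φ g ≡ φ g′ → g ≡ g′
    injective φ ψ ψφ g g′ sg sg′ φg≡φg′ = trans (sym (ψφ g sg)) (trans (cong ψ φg≡φg′) (ψφ g′ sg′))
    x-period : ∀ d → 0 ℕ.< d → pow z d ≡ I → ∃ λ e → 0 ℕ.< e × e ≤ d × pow x e ≡ I
    x-period = period-transfer x z f sx (injective f f⁻¹ f⁻¹f) λ k →
      Equivalence.to (compatible I (pow x k) SL-I (pow-SL x k sx)) (k , sym (·-identityʳ (pow x k)))
    z-period : ∀ d → 0 ℕ.< d → pow x d ≡ I → ∃ λ e → 0 ℕ.< e × e ≤ d × pow z e ≡ I
    z-period = period-transfer z x f⁻¹ sz (injective f⁻¹ f ff⁻¹) λ k →
      Equivalence.from (compatible (f⁻¹ I) (f⁻¹ (pow z k)) (f⁻¹SL I SL-I) (f⁻¹SL (pow z k) (pow-SL z k sz)))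
        (subst₂ (SameCoset z) (sym (ff⁻¹ I SL-I)) (sym (ff⁻¹ (pow z k) (pow-SL z k sz))) (k , sym (·-identityʳ (pow z k))))
    x-minimal : ∀ m → 0 ℕ.< m → m ℕ.< n → pow x m ≢ I
    x-minimal m 0<m m<n xᵐ≡I = shorter-z-period (z-period m 0<m xᵐ≡I)
      where
      shorter-z-period : (∃ λ e → 0 ℕ.< e × e ≤ m × pow z e ≡ I) → ⊥
      shorter-z-period (e , 0<e , e≤m , zᵉ≡I) = z-minimal e 0<e (ℕ.≤-<-trans e≤m m<n) zᵉ≡I
    xⁿ≡I : pow x n ≡ I
    xⁿ≡I = period-is-n (x-period n 0<n zⁿ≡I)
      where
      period-is-n : (∃ λ e → 0 ℕ.< e × e ≤ n × pow x e ≡ I) → pow x n ≡ I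
      period-is-n (e , 0<e , e≤n , xᵉ≡I) =
        [ (λ e<n → contradiction xᵉ≡I (x-minimal e 0<e e<n)) , (λ e≡n → subst (λ k → pow x k ≡ I) e≡n xᵉ≡I) ]′
          (ℕ.m≤n⇒m<n∨m≡n e≤n)

  HasOrder-bM : HasOrder bM p
  HasOrder-bM = ℕ.>-nonZero⁻¹ p , trans (pow-bM p) (cong lower fromℕ-p) , minimal
    where
    minimal : ∀ m → 0 ℕ.< m → m ℕ.< p → pow bM m ≢ I
    minimal m 0<m m<p bᵐ≡I = ℕ.<⇒≢ 0<m (sym (fromℕ-injective m<p (ℕ.>-nonZero⁻¹ p) (cong M2.c (trans (sym (pow-bM m)) bᵐ≡I))))

  HasOrder-wM : HasOrder wM p
  HasOrder-wM = ℕ.>-nonZero⁻¹ p , trans (pow-wM p) (cong upper fromℕ-p) , minimal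
    where
    minimal : ∀ m → 0 ℕ.< m → m ℕ.< p → pow wM m ≢ I
    minimal m 0<m m<p wᵐ≡I = ℕ.<⇒≢ 0<m (sym (fromℕ-injective m<p (ℕ.>-nonZero⁻¹ p) (cong M2.b (trans (sym (pow-wM m)) wᵐ≡I))))

  <p⇒≤p∸1 : ∀ {i} → i ℕ.< p → i ≤ p ∸ 1
  <p⇒≤p∸1 {i} i<p = subst (i ≤_) (ℕ.pred[m∸n]≡m∸[1+n] p 0) (ℕ.<⇒≤pred i<p)

  ≤p∸1⇒<p : ∀ {i} → i ≤ p ∸ 1 → i ℕ.< p
  ≤p∸1⇒<p {i} i≤p∸1 = ℕ.m≤pred[n]⇒suc[m]≤n (subst (i ≤_) (sym (ℕ.pred[m∸n]≡m∸[1+n] p 0)) i≤p∸1)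

  -- Conjugating the generators

  unipotent : F → F → F → M2
  unipotent a b c = mat a b c (2F - a)

  trace≡2⇒unipotent : ∀ a b c d → a + d ≡ 2F → mat a b c d ≡ unipotent a b c
  trace≡2⇒unipotent a b c d a+d≡2 = cong (mat a b c) (begin
    d            ≡⟨ solve 2 (λ a d → d := a :+ d :- a) refl a d ⟩
    a + d - a    ≡⟨ cong (_- a) a+d≡2 ⟩
    2F - a       ∎)

  det-unipotent : ∀ a b c → SL (unipotent a b c) → a * (2F - a) - b * c ≡ 1F
  det-unipotent a b c sU = trans (sym (det-mat a b c (2F - a))) sU

  Conjugate : M2 → M2 → Set
  Conjugate X X′ = Σ M2 λ P → det P ≢ 0F × X · P ≡ P · X′

  FixesE₂ : M2 → Set
  FixesE₂ g = M2.b g ≡ 0F × M2.d g ≡ 1F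

  FixesE₂-· : ∀ A B → FixesE₂ A → FixesE₂ B → FixesE₂ (A · B)
  FixesE₂-· (mat a .0F c .1F) (mat _ .0F _ .1F) (refl , refl) (refl , refl) = e₁₂ a , e₂₂ c
    where
    e₁₂ = solve 1 (λ a → a :* con 0ℤ :+ con 0ℤ :* con 1ℤ := con 0ℤ) refl
    e₂₂ = solve 1 (λ c → c :* con 0ℤ :+ con 1ℤ :* con 1ℤ := con 1ℤ) refl

  FixesE₂-⁻¹ : ∀ A B → A · B ≡ I → FixesE₂ B → FixesE₂ A
  FixesE₂-⁻¹ (mat a b c d) (mat _ .0F _ .1F) AB≡I (refl , refl) =
    trans (sym (e₁₂ a b)) (cong M2.b AB≡I) , trans (sym (e₂₂ c d)) (cong M2.d AB≡I)
    where
    e₁₂ = solve 2 (λ a b → a :* con 0ℤ :+ b :* con 1ℤ := b) refl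
    e₂₂ = solve 2 (λ c d → c :* con 0ℤ :+ d :* con 1ℤ := d) refl

  conj-Gen-FixesE₂ : ∀ x y P P⁻¹ → SL x → SL y → P⁻¹ · P ≡ I → P · P⁻¹ ≡ I →
                     FixesE₂ (conj P⁻¹ P x) → FixesE₂ (conj P⁻¹ P y) → ∀ {g} → Gen x y g → FixesE₂ (conj P⁻¹ P g)
  conj-Gen-FixesE₂ x y P P⁻¹ sx sy P⁻¹P≡I PP⁻¹≡I fixes-x fixes-y = fixes
    where
    φ : M2 → M2
    φ = conj P⁻¹ P
    step : ∀ g z → FixesE₂ (φ g) → FixesE₂ (φ z) → FixesE₂ (φ (g · z))
    step g z fixes-g fixes-z = subst FixesE₂ (sym (conj-· P P⁻¹ g z PP⁻¹≡I)) (FixesE₂-· (φ g) (φ z) fixes-g fixes-z)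
    step-inverse : ∀ z → SL z → FixesE₂ (φ z) → FixesE₂ (φ (inv z))
    step-inverse z sz = FixesE₂-⁻¹ (φ (inv z)) (φ z)
      (trans (sym (conj-· P P⁻¹ (inv z) z PP⁻¹≡I)) (trans (cong φ (·-inverseˡ z sz)) (conj-I P P⁻¹ P⁻¹P≡I)))
    fixes : ∀ {g} → Gen x y g → FixesE₂ (φ g)
    fixes gen-I          = subst FixesE₂ (sym (conj-I P P⁻¹ P⁻¹P≡I)) (refl , refl)
    fixes (gen-x {g} G)  = step g x (fixes G) fixes-x
    fixes (gen-y {g} G)  = step g y (fixes G) fixes-y
    fixes (gen-x⁻ {g} G) = step g (inv x) (fixes G) (step-inverse x sx fixes-x)
    fixes (gen-y⁻ {g} G) = step g (inv y) (fixes G) (step-inverse y sy fixes-y)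

  sandwich : F → F → M2
  sandwich t s = (upper t · lower s) · upper t

  trace-sandwich : ∀ t s → trace (sandwich t s) ≡ 2F * (1F + t * s)
  trace-sandwich = solve 2 (λ t s → (con 1ℤ :* con 1ℤ :+ t :* s) :* con 1ℤ :+ (con 1ℤ :* con 0ℤ :+ t :* con 1ℤ) :* con 0ℤ
                                    :+ ((con 0ℤ :* con 1ℤ :+ con 1ℤ :* s) :* t :+ (con 0ℤ :* con 0ℤ :+ con 1ℤ :* con 1ℤ) :* con 1ℤ)
                                    := (con 1ℤ :+ con 1ℤ) :* (con 1ℤ :+ t :* s)) refl

  sandwich-c : ∀ t s → M2.c (sandwich t s) ≡ s
  sandwich-c = solve 2 (λ t s → (con 0ℤ :* con 1ℤ :+ con 1ℤ :* s) :* con 1ℤ :+ (con 0ℤ :* con 0ℤ :+ con 1ℤ :* con 1ℤ) :* con 0ℤ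
                               := s) refl

  StandardForm OddStandardForm : M2 → M2 → Set
  StandardForm x y = ∃ λ i → 1 ≤ i × i ≤ p ∸ 1 × DessinIso x y bM (pow wM i)
  OddStandardForm x y = ∃ λ i → 1 ≤ i × i ≤ p ∸ 1 × DessinIso x y bM (pow wM i) × ∃ λ n → HasOrder (bM · pow wM i) n × ¬ 2 ∣ n

  module PrimeField (p-prime : Prime p) where

    1<p : 1 ℕ.< p
    1<p = ℕ.nonTrivial⇒n>1 p {{prime⇒nonTrivial p-prime}}

    1≢0 : 1F ≢ 0F
    1≢0 1≡0 = ℕ.<⇒≱ 1<p (∣⇒≤ (fromℕ≡0⇒p∣ 1 1≡0))

    *-integral : ∀ a b → a * b ≡ 0F → a ≡ 0F ⊎ b ≡ 0F
    *-integral a b ab≡0 = Sum.map (p∣toℕ⇒≡0F a) (p∣toℕ⇒≡0F b)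
      (euclidsLemma (toℕ a) (toℕ b) p-prime (fromℕ≡0⇒p∣ (toℕ a ℕ.* toℕ b) ab≡0))

    inverse : ∀ a → a ≢ 0F → ∃ λ a⁻¹ → a⁻¹ * a ≡ 1F
    inverse a a≢0 = from-Bézout (coprime-Bézout (prime⇒coprime p-prime {{nonZero}} (Fin.toℕ<n a)))
      where
      nonZero : NonZero (toℕ a)
      nonZero = ℕ.≢-nonZero (λ a≡0 → a≢0 (toℕ≡0⇒≡0F a a≡0))
      xp≡0 : ∀ x → fromℕ (x ℕ.* p) ≡ 0F
      xp≡0 x = p∣⇒fromℕ≡0 (x ℕ.* p) (n∣m*n x)
      fromℕ-y*a : ∀ y → fromℕ (y ℕ.* toℕ a) ≡ fromℕ y * a
      fromℕ-y*a y = trans (fromℕ-* y (toℕ a)) (cong (fromℕ y *_) (fromℕ-toℕ a))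
      from-Bézout : Bézout.Identity 1 p (toℕ a) → ∃ λ a⁻¹ → a⁻¹ * a ≡ 1F
      from-Bézout (Bézout.-+ x y 1+xp≡ya) = fromℕ y , (begin
        fromℕ y * a                  ≡⟨ fromℕ-y*a y ⟨
        fromℕ (y ℕ.* toℕ a)          ≡⟨ cong fromℕ 1+xp≡ya ⟨
        fromℕ (1 ℕ.+ x ℕ.* p)        ≡⟨ fromℕ-+ 1 (x ℕ.* p) ⟩
        1F + fromℕ (x ℕ.* p)         ≡⟨ cong (1F +_) (xp≡0 x) ⟩
        1F + 0F                      ≡⟨ +-identityʳ 1F ⟩
        1F                           ∎)
      from-Bézout (Bézout.+- x y 1+ya≡xp) = - fromℕ y , (begin
        - fromℕ y * a                ≡⟨ solve 2 (λ y a → :- y :* a := con 1ℤ :- (con 1ℤ :+ y :* a)) refl (fromℕ y) a ⟩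
        1F - (1F + fromℕ y * a)      ≡⟨ cong (λ u → 1F - (1F + u)) (fromℕ-y*a y) ⟨
        1F - (1F + fromℕ (y ℕ.* toℕ a))  ≡⟨ cong (λ u → 1F - u) (fromℕ-+ 1 (y ℕ.* toℕ a)) ⟨
        1F - fromℕ (1 ℕ.+ y ℕ.* toℕ a)   ≡⟨ cong (λ n → 1F - fromℕ n) 1+ya≡xp ⟩
        1F - fromℕ (x ℕ.* p)         ≡⟨ cong (λ u → 1F - u) (xp≡0 x) ⟩
        1F - 0F                      ≡⟨ solve 0 (con 1ℤ :- con 0ℤ := con 1ℤ) refl ⟩
        1F                           ∎)

    *-cancelˡ : ∀ a b c → a ≢ 0F → a * b ≡ a * c → b ≡ c
    *-cancelˡ a b c a≢0 ab≡ac = [ (λ a≡0 → contradiction a≡0 a≢0) , x-y≡0⇒x≡y b c ]′ (*-integral a (b - c) a[b-c]≡0)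
      where
      a[b-c]≡0 : a * (b - c) ≡ 0F
      a[b-c]≡0 = begin
        a * (b - c)       ≡⟨ solve 3 (λ a b c → a :* (b :- c) := a :* b :- a :* c) refl a b c ⟩
        a * b - a * c     ≡⟨ cong (_- a * c) ab≡ac ⟩
        a * c - a * c     ≡⟨ -‿inverseʳ (a * c) ⟩
        0F                ∎

    square≡1 : ∀ a → a * a ≡ 1F → a ≡ 1F ⊎ a ≡ - 1F
    square≡1 a a²≡1 = Sum.map (x-y≡0⇒x≡y a 1F) a+1≡0⇒a≡-1 (*-integral (a - 1F) (a + 1F) [a-1][a+1]≡0)
      where
      [a-1][a+1]≡0 : (a - 1F) * (a + 1F) ≡ 0F
      [a-1][a+1]≡0 = begin
        (a - 1F) * (a + 1F)   ≡⟨ solve 1 (λ a → (a :- con 1ℤ) :* (a :+ con 1ℤ) := a :* a :- con 1ℤ) refl a ⟩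
        a * a - 1F            ≡⟨ cong (_- 1F) a²≡1 ⟩
        1F - 1F               ≡⟨ -‿inverseʳ 1F ⟩
        0F                    ∎
      a+1≡0⇒a≡-1 : a + 1F ≡ 0F → a ≡ - 1F
      a+1≡0⇒a≡-1 a+1≡0 = x-y≡0⇒x≡y a (- 1F) (trans (cong (a +_) (-‿involutive 1F)) a+1≡0)

    det-pow≡0 : ∀ A n → det (pow A n) ≡ 0F → det A ≡ 0F
    det-pow≡0 A zero    det-I≡0 = contradiction (trans (sym SL-I) det-I≡0) 1≢0
    det-pow≡0 A (suc n) det≡0   = [ det-pow≡0 A n , id ]′ (*-integral (det (pow A n)) (det A) (trans (sym (det-· (pow A n) A)) det≡0))

    -- (g - I)ᵖ = gᵖ - I = 0, and det (g - I) = 2 - trace g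
    trace-of-order-p : ∀ g → SL g → pow g p ≡ I → trace g ≡ 2F
    trace-of-order-p g@(mat a b c d) sg gᵖ≡I = sym (x-y≡0⇒x≡y 2F (a + d) (begin
      2F - (a + d)                    ≡⟨ cong (λ δ → δ + 1F - (a + d)) (trans (sym (det-mat a b c d)) sg) ⟨
      (a * d - b * c) + 1F - (a + d)  ≡⟨ solve 4 (λ a b c d → (a :* d :- b :* c) :+ con 1ℤ :- (a :+ d)
                                                           := (a :- con 1ℤ) :* (d :- con 1ℤ) :- b :* c) refl a b c d ⟩
      (a - 1F) * (d - 1F) - b * c     ≡⟨ det-mat (a - 1F) b c (d - 1F) ⟨
      det N                           ≡⟨ det-pow≡0 N p (trans (cong det Nᵖ≡0) det-0ᴹ) ⟩
      0F                              ∎))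
      where
      N = mat (a - 1F) b c (d - 1F)
      N+I≡g : N +ᴹ I ≡ g
      N+I≡g = mat-≡ (x-1+1 a) (+-identityʳ b) (+-identityʳ c) (x-1+1 d)
        where x-1+1 = solve 1 (λ x → x :- con 1ℤ :+ con 1ℤ := x) refl
      characteristic-p : p ×ₙ I ≡ 0ᴹ
      characteristic-p = trans (×ₙ-I p) (cong scalar fromℕ-p)
      Nᵖ≡0 : pow N p ≡ 0ᴹ
      Nᵖ≡0 = begin
        pow N p     ≡⟨ ^≡pow N p ⟨
        N ^ p       ≡⟨ +ᴹ-cancelˡ I (N ^ p) 0ᴹ (begin
          I +ᴹ N ^ p      ≡⟨ [x+1]^q≈1+x^q (Ring.semiring +ᴹ-·-ring) p-prime characteristic-p N ⟨
          (N +ᴹ I) ^ p    ≡⟨ cong (_^ p) N+I≡g ⟩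
          g ^ p           ≡⟨ ^≡pow g p ⟩
          pow g p         ≡⟨ gᵖ≡I ⟩
          I               ≡⟨ +ᴹ-identityʳ I ⟨
          I +ᴹ 0ᴹ         ∎) ⟩
        0ᴹ          ∎

    HasOrder-p⇒≢I : ∀ x → HasOrder x p → x ≢ I
    HasOrder-p⇒≢I x (_ , _ , minimal) x≡I = minimal 1 (ℕ.s≤s ℕ.z≤n) 1<p (trans (·-identityˡ x) x≡I)

    GL-inverse : ∀ P → det P ≢ 0F → ∃ λ P⁻¹ → P⁻¹ · P ≡ I × P · P⁻¹ ≡ I
    GL-inverse P det≢0 = scalar s · inv P , P⁻¹P≡I , PP⁻¹≡I
      where
      s = proj₁ (inverse (det P) det≢0)
      s·det≡I : scalar s · scalar (det P) ≡ I
      s·det≡I = trans (scalar-· s (det P)) (cong scalar (proj₂ (inverse (det P) det≢0)))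
      P⁻¹P≡I : (scalar s · inv P) · P ≡ I
      P⁻¹P≡I = begin
        (scalar s · inv P) · P         ≡⟨ ·-assoc (scalar s) (inv P) P ⟩
        scalar s · (inv P · P)         ≡⟨ cong (scalar s ·_) (adjugate-· P) ⟩
        scalar s · scalar (det P)      ≡⟨ s·det≡I ⟩
        I                              ∎
      PP⁻¹≡I : P · (scalar s · inv P) ≡ I
      PP⁻¹≡I = begin
        P · (scalar s · inv P)         ≡⟨ ·-assoc P (scalar s) (inv P) ⟨
        (P · scalar s) · inv P         ≡⟨ cong (_· inv P) (scalar-comm s P) ⟨
        (scalar s · P) · inv P         ≡⟨ ·-assoc (scalar s) P (inv P) ⟩
        scalar s · (P · inv P)         ≡⟨ cong (scalar s ·_) (·-adjugate P) ⟩
        scalar s · scalar (det P)      ≡⟨ s·det≡I ⟩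
        I                              ∎

    DessinIso-GL : ∀ P {x y x′ y′} → det P ≢ 0F → x · P ≡ P · x′ → y · P ≡ P · y′ → DessinIso x y x′ y′
    DessinIso-GL P {x} {y} {x′} {y′} det≢0 =
      DessinIso-conj P (proj₁ P⁻¹) {x} {y} {x′} {y′} (proj₁ (proj₂ P⁻¹)) (proj₂ (proj₂ P⁻¹))
      where P⁻¹ = GL-inverse P det≢0

    unipotent-triangular⇒a≡1 : ∀ a b c → SL (unipotent a b c) → b * c ≡ 0F → a ≡ 1F
    unipotent-triangular⇒a≡1 a b c sU bc≡0 = [ x-y≡0⇒x≡y a 1F , x-y≡0⇒x≡y a 1F ]′ (*-integral (a - 1F) (a - 1F) [a-1]²≡0)
      where
      [a-1]²≡0 : (a - 1F) * (a - 1F) ≡ 0F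
      [a-1]²≡0 = begin
        (a - 1F) * (a - 1F)   ≡⟨ modulo-det (- (b * c)) 1F
                                   (solve 3 (λ a b c → (a :- con 1ℤ) :* (a :- con 1ℤ)
                                                    := :- (b :* c) :+ con 1ℤ :* (con 1ℤ :- (a :* (con 1ℤ :+ con 1ℤ :- a) :- b :* c)))
                                            refl a b c)
                                   (det-unipotent a b c sU) ⟩
        - (b * c)             ≡⟨ cong -_ bc≡0 ⟩
        - 0F                  ≡⟨ -0#≈0# ⟩
        0F                    ∎

    upper⇒Conjugate-bM : ∀ b → b ≢ 0F → Conjugate (unipotent 1F b 0F) bM
    upper⇒Conjugate-bM b b≢0 = mat 0F b 1F 0F , det≢0 , mat-≡ (e₁₁ b) (e₁₂ b) e₂₁ (e₂₂ b)
      where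
      det≢0 : det (mat 0F b 1F 0F) ≢ 0F
      det≢0 det≡0 = -‿≢0 b b≢0 (trans (sym (trans (det-mat 0F b 1F 0F) (det≡-b b))) det≡0)
        where det≡-b = solve 1 (λ b → con 0ℤ :* con 0ℤ :- b :* con 1ℤ := :- b) refl
      e₁₁ = solve 1 (λ b → con 1ℤ :* con 0ℤ :+ b :* con 1ℤ := con 0ℤ :* con 1ℤ :+ b :* con 1ℤ) refl
      e₁₂ = solve 1 (λ b → con 1ℤ :* b :+ b :* con 0ℤ := con 0ℤ :* con 0ℤ :+ b :* con 1ℤ) refl
      e₂₁ = solve 0 (con 0ℤ :* con 0ℤ :+ (con 1ℤ :+ con 1ℤ :- con 1ℤ) :* con 1ℤ := con 1ℤ :* con 1ℤ :+ con 0ℤ :* con 1ℤ) refl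
      e₂₂ = solve 1 (λ b → con 0ℤ :* b :+ (con 1ℤ :+ con 1ℤ :- con 1ℤ) :* con 0ℤ
                         := con 1ℤ :* con 0ℤ :+ con 0ℤ :* con 1ℤ) refl

    -- P has columns v and (U - I) v, where v = e₁ if c ≢ 0 and v = e₂ otherwise
    unipotent-Conjugate-bM : ∀ a b c → Dec (c ≡ 0F) → SL (unipotent a b c) → unipotent a b c ≢ I →
                             Conjugate (unipotent a b c) bM
    unipotent-Conjugate-bM a b c (no c≢0) sU U≢I = mat 1F (a - 1F) 0F c , det≢0 , mat-≡ (e₁₁ a b) e₁₂ (e₂₁ a c) (e₂₂ a c)
      where
      det≢0 : det (mat 1F (a - 1F) 0F c) ≢ 0F
      det≢0 det≡0 = c≢0 (trans (sym (trans (det-mat 1F (a - 1F) 0F c) (det≡c a c))) det≡0)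
        where det≡c = solve 2 (λ a c → con 1ℤ :* c :- (a :- con 1ℤ) :* con 0ℤ := c) refl
      e₁₁ = solve 2 (λ a b → a :* con 1ℤ :+ b :* con 0ℤ := con 1ℤ :* con 1ℤ :+ (a :- con 1ℤ) :* con 1ℤ) refl
      e₁₂ : a * (a - 1F) + b * c ≡ 1F * 0F + (a - 1F) * 1F
      e₁₂ = modulo-det (1F * 0F + (a - 1F) * 1F) 1F
              (solve 3 (λ a b c → a :* (a :- con 1ℤ) :+ b :* c
                                := con 1ℤ :* con 0ℤ :+ (a :- con 1ℤ) :* con 1ℤ
                                   :+ con 1ℤ :* (con 1ℤ :- (a :* (con 1ℤ :+ con 1ℤ :- a) :- b :* c))) refl a b c)
              (det-unipotent a b c sU)
      e₂₁ = solve 2 (λ a c → c :* con 1ℤ :+ (con 1ℤ :+ con 1ℤ :- a) :* con 0ℤ := con 0ℤ :* con 1ℤ :+ c :* con 1ℤ) refl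
      e₂₂ = solve 2 (λ a c → c :* (a :- con 1ℤ) :+ (con 1ℤ :+ con 1ℤ :- a) :* c := con 0ℤ :* con 0ℤ :+ c :* con 1ℤ) refl
    unipotent-Conjugate-bM a b .0F (yes refl) sU U≢I =
      subst (λ a → Conjugate (unipotent a b 0F) bM) (sym a≡1) (upper⇒Conjugate-bM b b≢0)
      where
      a≡1 : a ≡ 1F
      a≡1 = unipotent-triangular⇒a≡1 a b 0F sU (zeroʳ b)
      b≢0 : b ≢ 0F
      b≢0 b≡0 = U≢I (mat-≡ a≡1 b≡0 refl (trans (cong (λ u → 2F - u) a≡1) 2-1≡1))
        where 2-1≡1 = solve 0 (con 1ℤ :+ con 1ℤ :- con 1ℤ := con 1ℤ) refl

    unipotent⇒Conjugate-bM : ∀ X → SL X → trace X ≡ 2F → X ≢ I → Conjugate X bM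
    unipotent⇒Conjugate-bM (mat a b c d) sX trX X≢I =
      subst (λ X → Conjugate X bM) (sym X≡U)
        (unipotent-Conjugate-bM a b c (c Fin.≟ 0F) (subst SL X≡U sX) (λ U≡I → X≢I (trans X≡U U≡I)))
      where X≡U = trace≡2⇒unipotent a b c d trX

    unipotent-lower-conjugate : ∀ a β c → β ≢ 0F → SL (unipotent a β c) →
                                ∃ λ γ → unipotent a β c · lower γ ≡ lower γ · upper β
    unipotent-lower-conjugate a β c β≢0 sU = γ , mat-≡ e₁₁ (e₁₂ a β) e₂₁ e₂₂
      where
      β⁻¹ = proj₁ (inverse β β≢0)
      γ = (1F - a) * β⁻¹
      γβ≡1-a : γ * β ≡ 1F - a
      γβ≡1-a = begin
        (1F - a) * β⁻¹ * β        ≡⟨ *-assoc (1F - a) β⁻¹ β ⟩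
        (1F - a) * (β⁻¹ * β)      ≡⟨ cong ((1F - a) *_) (proj₂ (inverse β β≢0)) ⟩
        (1F - a) * 1F             ≡⟨ *-identityʳ (1F - a) ⟩
        1F - a                    ∎
      e₁₁ : a * 1F + β * γ ≡ 1F * 1F + 0F * 0F
      e₁₁ = begin
        a * 1F + β * γ            ≡⟨ solve 3 (λ a β γ → a :* con 1ℤ :+ β :* γ := a :+ γ :* β) refl a β γ ⟩
        a + γ * β                 ≡⟨ cong (a +_) γβ≡1-a ⟩
        a + (1F - a)              ≡⟨ solve 1 (λ a → a :+ (con 1ℤ :- a) := con 1ℤ :* con 1ℤ :+ con 0ℤ :* con 0ℤ) refl a ⟩
        1F * 1F + 0F * 0F         ∎
      e₁₂ = solve 2 (λ a β → a :* con 0ℤ :+ β :* con 1ℤ := con 1ℤ :* β :+ con 0ℤ :* con 1ℤ) refl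
      e₂₁ : c * 1F + (2F - a) * γ ≡ γ * 1F + 1F * 0F
      e₂₁ = *-cancelˡ β (c * 1F + (2F - a) * γ) (γ * 1F + 1F * 0F) β≢0 (begin
        β * (c * 1F + (2F - a) * γ)       ≡⟨ solve 4 (λ a β c γ → β :* (c :* con 1ℤ :+ (con 1ℤ :+ con 1ℤ :- a) :* γ)
                                                             := β :* c :+ (con 1ℤ :+ con 1ℤ :- a) :* (γ :* β)) refl a β c γ ⟩
        β * c + (2F - a) * (γ * β)        ≡⟨ cong (λ u → β * c + (2F - a) * u) γβ≡1-a ⟩
        β * c + (2F - a) * (1F - a)       ≡⟨ modulo-det (1F - a) 1F
                                               (solve 3 (λ a β c → β :* c :+ (con 1ℤ :+ con 1ℤ :- a) :* (con 1ℤ :- a)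
                                                                 := (con 1ℤ :- a)
                                                                    :+ con 1ℤ :* (con 1ℤ :- (a :* (con 1ℤ :+ con 1ℤ :- a) :- β :* c)))
                                                        refl a β c)
                                               (det-unipotent a β c sU) ⟩
        1F - a                            ≡⟨ γβ≡1-a ⟨
        γ * β                             ≡⟨ solve 2 (λ β γ → γ :* β := β :* (γ :* con 1ℤ :+ con 1ℤ :* con 0ℤ)) refl β γ ⟩
        β * (γ * 1F + 1F * 0F)            ∎)
      e₂₂ : c * 0F + (2F - a) * 1F ≡ γ * β + 1F * 1F
      e₂₂ = begin
        c * 0F + (2F - a) * 1F            ≡⟨ solve 2 (λ a c → c :* con 0ℤ :+ (con 1ℤ :+ con 1ℤ :- a) :* con 1ℤ
                                                            := (con 1ℤ :- a) :+ con 1ℤ :* con 1ℤ) refl a c ⟩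
        (1F - a) + 1F * 1F                ≡⟨ cong (_+ 1F * 1F) γβ≡1-a ⟨
        γ * β + 1F * 1F                   ∎

    unipotent⇒DessinIso-upper : ∀ Y → SL Y → trace Y ≡ 2F → M2.b Y ≢ 0F → DessinIso bM Y bM (upper (M2.b Y))
    unipotent⇒DessinIso-upper (mat a β c d) sY trY β≢0 = from-conjugator (unipotent-lower-conjugate a β c β≢0 (subst SL Y≡U sY))
      where
      Y≡U = trace≡2⇒unipotent a β c d trY
      from-conjugator : (∃ λ γ → unipotent a β c · lower γ ≡ lower γ · upper β) → DessinIso bM (mat a β c d) bM (upper β)
      from-conjugator (γ , UC≡CW) =
        DessinIso-GL (lower γ) {bM} {mat a β c d} {bM} {upper β} (λ det≡0 → 1≢0 (trans (sym (SL-lower γ)) det≡0))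
          (lower-comm 1F γ) (trans (cong (_· lower γ) Y≡U) UC≡CW)

    SL-scalar⇒±I : ∀ a → SL (scalar a) → scalar a ≡ I ⊎ scalar a ≡ -I
    SL-scalar⇒±I a sa = Sum.map (cong scalar) (cong scalar)
      (square≡1 a (trans (solve 1 (λ a → a :* a := a :* a :- con 0ℤ :* con 0ℤ) refl a) (trans (sym (det-mat a 0F 0F a)) sa)))

    Central⇒±I : ∀ z → Central z → z ≡ I ⊎ z ≡ -I
    Central⇒±I (mat a b c d) (sz , commutes) =
      subst (λ z → z ≡ I ⊎ z ≡ -I) (sym z≡scalar) (SL-scalar⇒±I a (subst SL z≡scalar sz))
      where
      zb≡bz = commutes bM (SL-lower 1F)
      zw≡wz = commutes wM (SL-upper 1F)
      b≡0 : b ≡ 0F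
      b≡0 = x≡y-y⇒x≡0 (1F * a + 0F * c)
              (trans (solve 3 (λ a b c → b := (a :* con 1ℤ :+ b :* con 1ℤ) :- (con 1ℤ :* a :+ con 0ℤ :* c)) refl a b c)
                     (cong (_- (1F * a + 0F * c)) (cong M2.a zb≡bz)))
      c≡0 : c ≡ 0F
      c≡0 = x≡y-y⇒x≡0 (a * 1F + b * 0F)
              (trans (solve 3 (λ a b c → c := (con 1ℤ :* a :+ con 1ℤ :* c) :- (a :* con 1ℤ :+ b :* con 0ℤ)) refl a b c)
                     (cong (_- (a * 1F + b * 0F)) (sym (cong M2.a zw≡wz))))
      d≡a : d ≡ a
      d≡a = x-y≡0⇒x≡y d a (x≡y-y⇒x≡0 (1F * a + 1F * c)
              (trans (solve 3 (λ a c d → d :- a := (c :* con 1ℤ :+ d :* con 1ℤ) :- (con 1ℤ :* a :+ con 1ℤ :* c)) refl a c d)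
                     (cong (_- (1F * a + 1F * c)) (cong M2.c zb≡bz))))
      z≡scalar : mat a b c d ≡ scalar a
      z≡scalar = mat-≡ refl b≡0 c≡0 d≡a

    odd-order⇒SameOrderModN : ∀ g {n} → SL g → HasOrder g n → ¬ 2 ∣ n → SameOrderModN g
    odd-order⇒SameOrderModN g {n} sg order@(0<n , gⁿ≡I , minimal) n-odd =
      n , order , 0<n , subst Central (sym gⁿ≡I) (Central-scalar 1F SL-I) , not-central
      where
      not-central : ∀ m → 0 ℕ.< m → m ℕ.< n → ¬ Central (pow g m)
      not-central m 0<m m<n central = [ minimal m 0<m m<n , gᵐ≢-I ]′ (Central⇒±I (pow g m) central)
        where
        gᵐ≢-I : pow g m ≢ -I
        gᵐ≢-I gᵐ≡-I = ℕ.<⇒≱ m<n (∣⇒≤ {{ℕ.>-nonZero 0<m}} (coprime-divisor (odd⇒coprime-2 n-odd) n∣2m))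
          where
          n∣2m : n ∣ 2 ℕ.* m
          n∣2m = HasOrder⇒∣ order (2 ℕ.* m) (begin
            pow g (2 ℕ.* m)       ≡⟨ cong (λ k → pow g (m ℕ.+ k)) (ℕ.+-identityʳ m) ⟩
            pow g (m ℕ.+ m)       ≡⟨ pow-+ g m m ⟩
            pow g m · pow g m     ≡⟨ cong₂ _·_ gᵐ≡-I gᵐ≡-I ⟩
            -I · -I               ≡⟨ -I·-I≡I ⟩
            I                     ∎)

    module OddPrime (p≢2 : p ≢ 2) where

      2≢0 : 2F ≢ 0F
      2≢0 2≡0 = p≢2 (ℕ.≤-antisym (∣⇒≤ (fromℕ≡0⇒p∣ 2 (trans (fromℕ-+ 1 1) 2≡0))) 1<p)

      -1≢1 : - 1F ≢ 1F
      -1≢1 -1≡1 = 2≢0 (begin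
        1F + 1F       ≡⟨ cong (1F +_) -1≡1 ⟨
        1F + - 1F     ≡⟨ -‿inverseʳ 1F ⟩
        0F            ∎)

      p-odd : ¬ 2 ∣ p
      p-odd 2∣p = [ (λ ()) , (λ 2≡p → p≢2 (sym 2≡p)) ]′ (prime⇒irreducible p-prime 2∣p)

      x≡-x⇒x≡0 : ∀ x → x ≡ - x → x ≡ 0F
      x≡-x⇒x≡0 x x≡-x = [ (λ 2≡0 → contradiction 2≡0 2≢0) , id ]′ (*-integral 2F x 2x≡0)
        where
        2x≡0 : 2F * x ≡ 0F
        2x≡0 = begin
          2F * x          ≡⟨ solve 1 (λ x → (con 1ℤ :+ con 1ℤ) :* x := x :+ x) refl x ⟩
          x + x           ≡⟨ cong (x +_) x≡-x ⟩
          x + - x         ≡⟨ -‿inverseʳ x ⟩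
          0F              ∎

      -- an involution equals its inverse, the adjugate, so it is scalar
      involution⇒±I : ∀ h → SL h → h · h ≡ I → h ≡ I ⊎ h ≡ -I
      involution⇒±I h@(mat a b c d) sh h²≡I =
        subst (λ h → h ≡ I ⊎ h ≡ -I) (sym h≡scalar) (SL-scalar⇒±I a (subst SL h≡scalar sh))
        where
        h≡adj : h ≡ inv h
        h≡adj = ·-cancelˡ h (inv h) h sh (trans h²≡I (sym (·-inverseʳ h sh)))
        h≡scalar : h ≡ scalar a
        h≡scalar = mat-≡ refl (x≡-x⇒x≡0 b (cong M2.b h≡adj)) (x≡-x⇒x≡0 c (cong M2.c h≡adj)) (sym (cong M2.a h≡adj))

      SameOrderModN⇒odd-order : ∀ g → SL g → SameOrderModN g → ∃ λ n → HasOrder g n × ¬ 2 ∣ n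
      SameOrderModN⇒odd-order g sg (n , order@(0<n , gⁿ≡I , _) , (_ , _ , not-central)) = n , order , n-odd
        where
        n-odd : ¬ 2 ∣ n
        n-odd (divides q n≡q*2) = not-central q 0<q q<n (central (involution⇒±I (pow g q) (pow-SL g q sg) gᵠgᵠ≡I))
          where
          n≡q+q : n ≡ q ℕ.+ q
          n≡q+q = trans n≡q*2 (trans (ℕ.*-comm q 2) (cong (q ℕ.+_) (ℕ.+-identityʳ q)))
          0<q : 0 ℕ.< q
          0<q = ℕ.n≢0⇒n>0 (λ q≡0 → ℕ.<⇒≢ 0<n (sym (trans n≡q+q (cong₂ ℕ._+_ q≡0 q≡0))))
          q<n : q ℕ.< n
          q<n = subst (q ℕ.<_) (sym n≡q+q) (ℕ.m<m+n q 0<q)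
          gᵠgᵠ≡I : pow g q · pow g q ≡ I
          gᵠgᵠ≡I = trans (sym (pow-+ g q q)) (trans (cong (pow g) (sym n≡q+q)) gⁿ≡I)
          central : pow g q ≡ I ⊎ pow g q ≡ -I → Central (pow g q)
          central (inj₁ gᵠ≡I)  = subst Central (sym gᵠ≡I) (Central-scalar 1F SL-I)
          central (inj₂ gᵠ≡-I) = subst Central (sym gᵠ≡-I) (Central-scalar (- 1F) SL--I)

      order-4⇒traceless : ∀ M → SL M → M2.c M ≢ 0F → (M · M) · (M · M) ≡ I → trace M ≡ 0F
      order-4⇒traceless M sM c≢0 M⁴≡I =
        [ (λ M²≡I → contradiction M²≡I M²≢I) , M²≡-I⇒traceless ]′ (involution⇒±I (M · M) (SL-· M M sM sM) M⁴≡I)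
        where
        ±I⇒c≡0 : ∀ {A} → A ≡ I ⊎ A ≡ -I → M2.c A ≡ 0F
        ±I⇒c≡0 (inj₁ refl) = refl
        ±I⇒c≡0 (inj₂ refl) = refl
        M²≢I : M · M ≢ I
        M²≢I M²≡I = c≢0 (±I⇒c≡0 (involution⇒±I M sM M²≡I))
        M²≡-I⇒traceless : M · M ≡ -I → trace M ≡ 0F
        M²≡-I⇒traceless M²≡-I = [ (λ c≡0 → contradiction c≡0 c≢0) , id ]′ (*-integral (M2.c M) (trace M) (begin
          M2.c M * trace M    ≡⟨ cong M2.c (cayley-hamilton M) ⟨
          M2.c (M · M)        ≡⟨ ±I⇒c≡0 (inj₂ M²≡-I) ⟩
          0F                  ∎))

      conjugate-b-entry≢0 : ∀ x y y′ P P⁻¹ → SL x → SL y → Generates x y → P⁻¹ · P ≡ I → P · P⁻¹ ≡ I →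
                            x · P ≡ P · bM → y · P ≡ P · y′ → SL y′ → trace y′ ≡ 2F → M2.b y′ ≢ 0F
      conjugate-b-entry≢0 x y (mat a b c d) P P⁻¹ sx sy generates P⁻¹P≡I PP⁻¹≡I xP≡PbM yP≡Py′ sy′ tr b≡0 =
        -1≢1 (proj₂ (subst FixesE₂ (conj-scalar P P⁻¹ (- 1F) P⁻¹P≡I) (fixes (generates -I SL--I))))
        where
        y′≡U = trace≡2⇒unipotent a b c d tr
        a≡1 : a ≡ 1F
        a≡1 = unipotent-triangular⇒a≡1 a b c (subst SL y′≡U sy′) (trans (cong (_* c) b≡0) (zeroˡ c))
        d≡1 : d ≡ 1F
        d≡1 = trans (cong M2.d y′≡U) (trans (cong (λ u → 2F - u) a≡1) (solve 0 (con 1ℤ :+ con 1ℤ :- con 1ℤ := con 1ℤ) refl))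
        fixes : ∀ {g} → Gen x y g → FixesE₂ (conj P⁻¹ P g)
        fixes = conj-Gen-FixesE₂ x y P P⁻¹ sx sy P⁻¹P≡I PP⁻¹≡I
                  (subst FixesE₂ (sym (intertwiner⇒conj≡ P P⁻¹ x bM P⁻¹P≡I xP≡PbM)) (refl , refl))
                  (subst FixesE₂ (sym (intertwiner⇒conj≡ P P⁻¹ y (mat a b c d) P⁻¹P≡I yP≡Py′)) (b≡0 , d≡1))

      DessinIso-bM-wⁱ : ∀ x y → SL x → SL y → Generates x y → HasOrder x p → HasOrder y p → StandardForm x y
      DessinIso-bM-wⁱ x y sx sy generates x-order@(_ , xᵖ≡I , _) (_ , yᵖ≡I , _) =
        toℕ β , ℕ.n≢0⇒n>0 (λ i≡0 → β≢0 (toℕ≡0⇒≡0F β i≡0)) , <p⇒≤p∸1 (Fin.toℕ<n β) ,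
        subst (DessinIso x y bM) (sym wⁱ≡upper-β)
          (DessinIso-trans {x} {y} {bM} {y′} {bM} {upper β} x↦bM (unipotent⇒DessinIso-upper y′ sy′ y′-trace β≢0))
        where
        x∼bM = unipotent⇒Conjugate-bM x sx (trace-of-order-p x sx xᵖ≡I) (HasOrder-p⇒≢I x x-order)
        P = proj₁ x∼bM
        xP≡PbM = proj₂ (proj₂ x∼bM)
        P-invertible = GL-inverse P (proj₁ (proj₂ x∼bM))
        P⁻¹ = proj₁ P-invertible
        P⁻¹P≡I = proj₁ (proj₂ P-invertible)
        PP⁻¹≡I = proj₂ (proj₂ P-invertible)
        y′ = conj P⁻¹ P y
        yP≡Py′ = conj-intertwiner P P⁻¹ y PP⁻¹≡I
        x↦bM : DessinIso x y bM y′
        x↦bM = DessinIso-conj P P⁻¹ {x} {y} {bM} {y′} P⁻¹P≡I PP⁻¹≡I xP≡PbM yP≡Py′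
        sy′ : SL y′
        sy′ = SL-conj P⁻¹ P P⁻¹P≡I y sy
        y↦y′ : Intertwines (conj P⁻¹ P) y y′
        y↦y′ = proj₂ (proj₂ (proj₂ x↦bM))
        y′-trace : trace y′ ≡ 2F
        y′-trace = trace-of-order-p y′ sy′ (intertwines-pow-≡I y y′ sy (SL-conj P⁻¹ P P⁻¹P≡I I SL-I) y↦y′ p yᵖ≡I)
        β = M2.b y′
        β≢0 : β ≢ 0F
        β≢0 = conjugate-b-entry≢0 x y y′ P P⁻¹ sx sy generates P⁻¹P≡I PP⁻¹≡I xP≡PbM yP≡Py′ sy′ y′-trace
        wⁱ≡upper-β : pow wM (toℕ β) ≡ upper β
        wⁱ≡upper-β = trans (pow-wM (toℕ β)) (cong upper (fromℕ-toℕ β))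

      -- with κ = u⁻¹, the element S u = wᵘ b⁻ᵏ wᵘ is traceless and hence of order 4
      DessinIso-upper⇒≡ : ∀ u v → u ≢ 0F → DessinIso bM (upper u) bM (upper v) → u ≡ v
      DessinIso-upper⇒≡ u v u≢0 (f , (fSL , _) , fb , fw) =
        sym (*-cancelˡ κ v u κ≢0 (trans (*-comm κ v) (trans vκ≡1 (sym κu≡1))))
        where
        κ = proj₁ (inverse u u≢0)
        κu≡1 = proj₂ (inverse u u≢0)
        κ≢0 : κ ≢ 0F
        κ≢0 κ≡0 = 1≢0 (trans (sym κu≡1) (trans (cong (_* u) κ≡0) (zeroˡ u)))
        S : F → M2
        S t = sandwich t (- κ)
        SL-S : ∀ t → SL (S t)
        SL-S t = SL-· (upper t · lower (- κ)) (upper t) (SL-· (upper t) (lower (- κ)) (SL-upper t) (SL-lower (- κ))) (SL-upper t)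
        trace-S : ∀ t → trace (S t) ≡ 2F * (1F - t * κ)
        trace-S t = trans (trace-sandwich t (- κ)) (cong (λ w → 2F * (1F + w)) (sym (-‿distribʳ-* t κ)))
        f-b⁻ᵏ : Intertwines f (lower (- κ)) (lower (- κ))
        f-b⁻ᵏ = subst (λ A → Intertwines f A A) bᵐ≡lower-κ (intertwines-pow bM bM (SL-lower 1F) fb (toℕ (- κ)))
          where bᵐ≡lower-κ = trans (pow-bM (toℕ (- κ))) (cong lower (fromℕ-toℕ (- κ)))
        f-S : Intertwines f (S u) (S v)
        f-S = intertwines-· (upper u · lower (- κ)) (upper u) (upper v · lower (- κ)) (upper v) (SL-upper u)
                (intertwines-· (upper u) (lower (- κ)) (upper v) (lower (- κ)) (SL-lower (- κ)) fw f-b⁻ᵏ) fw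
        Su²≡-I : S u · S u ≡ -I
        Su²≡-I = traceless⇒square≡-I (S u) (SL-S u) (begin
          trace (S u)                ≡⟨ trace-S u ⟩
          2F * (1F - u * κ)          ≡⟨ cong (λ w → 2F * (1F - w)) (trans (*-comm u κ) κu≡1) ⟩
          2F * (1F - 1F)             ≡⟨ solve 0 ((con 1ℤ :+ con 1ℤ) :* (con 1ℤ :- con 1ℤ) := con 0ℤ) refl ⟩
          0F                         ∎)
        Su⁴≡I : pow (S u) 4 ≡ I
        Su⁴≡I = trans (pow-4 (S u)) (trans (cong₂ _·_ Su²≡-I Su²≡-I) -I·-I≡I)
        Sv⁴≡I : (S v · S v) · (S v · S v) ≡ I
        Sv⁴≡I = trans (sym (pow-4 (S v))) (intertwines-pow-≡I {f} (S u) (S v) (SL-S u) (fSL I SL-I) f-S 4 Su⁴≡I)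
        trace-Sv≡0 : trace (S v) ≡ 0F
        trace-Sv≡0 = order-4⇒traceless (S v) (SL-S v) (λ c≡0 → -‿≢0 κ κ≢0 (trans (sym (sandwich-c v (- κ))) c≡0)) Sv⁴≡I
        vκ≡1 : v * κ ≡ 1F
        vκ≡1 = [ (λ 2≡0 → contradiction 2≡0 2≢0) , (λ 1-vκ≡0 → sym (x-y≡0⇒x≡y 1F (v * κ) 1-vκ≡0)) ]′
                 (*-integral 2F (1F - v * κ) (trans (sym (trace-S v)) trace-Sv≡0))

      distinct-exponents : ∀ i j → 1 ≤ i → i ≤ p ∸ 1 → 1 ≤ j → j ≤ p ∸ 1 → i ≢ j →
                           ¬ DessinIso bM (pow wM i) bM (pow wM j)
      distinct-exponents i j 1≤i i≤p∸1 1≤j j≤p∸1 i≢j iso =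
        i≢j (fromℕ-injective (≤p∸1⇒<p i≤p∸1) (≤p∸1⇒<p j≤p∸1)
          (DessinIso-upper⇒≡ (fromℕ i) (fromℕ j) fromℕ-i≢0 (subst₂ (λ w w′ → DessinIso bM w bM w′) (pow-wM i) (pow-wM j) iso)))
        where
        fromℕ-i≢0 : fromℕ i ≢ 0F
        fromℕ-i≢0 i≡0 = ℕ.<⇒≢ 1≤i (sym (fromℕ-injective (≤p∸1⇒<p i≤p∸1) (ℕ.>-nonZero⁻¹ p) i≡0))

      SmoothCover⇔odd-order : ∀ x y → SL x → SL y → HasOrder x p → HasOrder y p → StandardForm x y →
                              SmoothCover x y ⇔ OddStandardForm x y
      SmoothCover⇔odd-order x y sx sy x-order y-order (i , 1≤i , i≤p∸1 , iso) = mk⇔ smooth⇒odd odd⇒smooth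
        where
        sxy = SL-· x y sx sy
        smooth⇒odd : SmoothCover x y → OddStandardForm x y
        smooth⇒odd (_ , _ , xy-smooth) =
          i , 1≤i , i≤p∸1 , iso , n ,
          DessinIso-HasOrder-xy {x} {y} {bM} {pow wM i} sx sy (SL-lower 1F) (pow-SL wM i (SL-upper 1F)) iso (proj₁ n-odd-order) ,
          proj₂ n-odd-order
          where
          n = proj₁ (SameOrderModN⇒odd-order (x · y) sxy xy-smooth)
          n-odd-order = proj₂ (SameOrderModN⇒odd-order (x · y) sxy xy-smooth)
        odd⇒smooth : OddStandardForm x y → SmoothCover x y
        odd⇒smooth (j , _ , _ , iso-j , n , bwʲ-order , n-odd) =
          odd-order⇒SameOrderModN x sx x-order p-odd ,
          odd-order⇒SameOrderModN y sy y-order p-odd ,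
          odd-order⇒SameOrderModN (x · y) sxy
            (DessinIso-HasOrder-xy {bM} {pow wM j} {x} {y} (SL-lower 1F) (pow-SL wM j (SL-upper 1F)) sx sy
              (DessinIso-sym {x} {y} {bM} {pow wM j} sx sy iso-j) bwʲ-order) n-odd

mainTheorem16 : (p : ℕ) .{{nz : NonZero p}} → Prime p → p ≢ 2 →
    let open SL2 p in
    (x y : M2) → SL x → SL y → Generates x y → UnderlyingGraphIsΓ x y →
    (Σ ℕ λ i → 1 ≤ i × i ≤ p ∸ 1 × DessinIso x y bM (pow wM i))
    × (∀ i j → 1 ≤ i → i ≤ p ∸ 1 → 1 ≤ j → j ≤ p ∸ 1 → i ≢ j →
         ¬ DessinIso bM (pow wM i) bM (pow wM j))
    × (SmoothCover x y ⇔
         (Σ ℕ λ i → 1 ≤ i × i ≤ p ∸ 1 × DessinIso x y bM (pow wM i) ×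
            (∃ λ n → HasOrder (bM · pow wM i) n × ¬ (2 ∣ n))))
mainTheorem16 p p-prime p≢2 x y sx sy generates (f , bijective , black-cosets , white-cosets) =
  part-i , distinct-exponents , SmoothCover⇔odd-order x y sx sy x-order y-order part-i
  where
  open SL2 p
  open Dessins p
  open PrimeField p-prime
  open OddPrime p≢2
  x-order : HasOrder x p
  x-order = coset-compatible⇒HasOrder x bM f bijective black-cosets sx (SL-lower 1F) HasOrder-bM
  y-order : HasOrder y p
  y-order = coset-compatible⇒HasOrder y wM f bijective white-cosets sy (SL-upper 1F) HasOrder-wM
  part-i : StandardForm x y
  part-i = DessinIso-bM-wⁱ x y sx sy generates x-order y-order
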